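{- For every positive equivalence relation $\eta$, the ascending family $\mathcal{A}_\eta=\{A_n : n\in\mathbb{N}\}$ is explanatorily learnable but not confidently learnable. Moreover, $\mathcal{A}_\eta\cup\{\mathbb{N}\}$ is an $\eta$-family which is not behaviourally correctly learnable.
   Context: A positive equivalence relation is an equivalence relation $\eta$ on $\mathbb{N}$ that is recursively enumerable (as a set of pairs) and has infinitely many equivalence classes. For $x\in\mathbb N$ let $[x]=\{y: y\,\eta\,x\}$, for $D\subseteq \mathbb N$ let $[D]=\bigcup_{x\in D}[x]$, and write $[b_1,\dots,b_k]$ for $[\{b_1,\dots,b_k\}]$. Let $a_0<a_1<a_2<\cdots$ be the least elements of the $\eta$-equivalence classes, listed in increasing order, and $A_n=[a_0,\dots,a_{n-1}]$ (so $A_0=\emptyset$). A set is $\eta$-closed if it is a union of $\eta$-classes. An $\eta$-family is an infinite family of $\eta$-closed sets possessing a uniformly r.e. one-one numbering $B_0,B_1,\dots$ (i.e. $\{\langle k,x\rangle:x\in B_k\}$ is r.e. and $B_i\neq B_j$ for $i\ne j$). $W_0,W_1,\dots$ is a fixed acceptable numbering of the r.e. sets. A text for $L$ is a total $T:\mathbb N\to\mathbb N\cup\{\#\}$ whose range minus $\{\#\}$ is $L$; $T[n]$ is its initial segment of length $n$. A learner is a recursive function $M$ from finite sequences over $\mathbb N\cup\{\#\}$ to $\mathbb N\cup\{?\}$; an output $e$ is interpreted as the hypothesis "the $\eta$-closure of $W_e$". A family $\mathcal C$ is explanatorily learnable if some $M$, on every text $T$ for every $L\in\mathcal C$, outputs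 from some point on a single index $e$ whose hypothesis equals $L$; behaviourally correctly learnable if some $M$, on every such text, outputs for almost all $n$ an index $M(T[n])$ whose hypothesis equals $L$; confidently learnable if some $M$ explanatorily learns $\mathcal C$ and additionally, on every text for every set $L\subseteq\mathbb N$, the sequence $M(T[n])$ converges. -}

module Defs where

open import Data.Nat using (ℕ; zero; suc; _+_; _<_; _≤_)
open import Data.Product using (Σ; ∃; _×_; _,_; proj₁; proj₂)
open import Data.Sum using (_⊎_)
open import Data.Maybe using (Maybe; just; nothing)
open import Data.List using (List; []; _∷_; applyUpTo)
open import Data.List.Membership.Propositional using (_∈_)
open import Relation.Nullary using (¬_)
open import Relation.Binary.PropositionalEquality using (_≡_; _≢_)
open import Relation.Binary.Structures using (IsEquivalence)

tri : ℕ → ℕ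
tri zero    = zero
tri (suc n) = suc n + tri n

⟪_,_⟫ : ℕ → ℕ → ℕ
⟪ x , y ⟫ = tri (x + y) + y

-- inverse of the pairing (enumerates the diagonals in the same order)
nextPair : ℕ × ℕ → ℕ × ℕ
nextPair (zero  , y) = (suc y , zero)
nextPair (suc x , y) = (x , suc y)

unpair : ℕ → ℕ × ℕ
unpair zero    = (zero , zero)
unpair (suc n) = nextPair (unpair n)

-- A model of computation: unary partial recursive functions
-- (using the pairing to code tuples)

data Code : Set where
  Z S Fst Snd : Code
  Comp Pair Rec : Code → Code → Code
  Mu : Code → Code

data _⊢_↦_ : Code → ℕ → ℕ → Set where
  ev-Z    : ∀ {x} → Z ⊢ x ↦ zero
  ev-S    : ∀ {x} → S ⊢ x ↦ suc x
  ev-Fst  : ∀ {x y} → Fst ⊢ ⟪ x , y ⟫ ↦ x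
  ev-Snd  : ∀ {x y} → Snd ⊢ ⟪ x , y ⟫ ↦ y
  ev-Comp : ∀ {f g x y z} → g ⊢ x ↦ y → f ⊢ y ↦ z → Comp f g ⊢ x ↦ z
  ev-Pair : ∀ {f g x y z} → f ⊢ x ↦ y → g ⊢ x ↦ z → Pair f g ⊢ x ↦ ⟪ y , z ⟫
  ev-Rec0 : ∀ {f g x z} → f ⊢ x ↦ z → Rec f g ⊢ ⟪ x , zero ⟫ ↦ z
  ev-RecS : ∀ {f g x y z w} → Rec f g ⊢ ⟪ x , y ⟫ ↦ z →
            g ⊢ ⟪ ⟪ x , y ⟫ , z ⟫ ↦ w → Rec f g ⊢ ⟪ x , suc y ⟫ ↦ w
  ev-Mu   : ∀ {f x y} → f ⊢ ⟪ x , y ⟫ ↦ zero →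
            (∀ k → k < y → Σ ℕ λ v → f ⊢ ⟪ x , k ⟫ ↦ suc v) →
            Mu f ⊢ x ↦ y

-- Gödel numbering of codes (decodeF with enough fuel is onto)
decodeF : ℕ → ℕ → Code
decodeF zero _ = Z
decodeF (suc f) n with unpair n
... | (0 , r) = Z
... | (1 , r) = S
... | (2 , r) = Fst
... | (3 , r) = Snd
... | (4 , r) = Comp (decodeF f (proj₁ (unpair r))) (decodeF f (proj₂ (unpair r)))
... | (5 , r) = Pair (decodeF f (proj₁ (unpair r))) (decodeF f (proj₂ (unpair r)))
... | (6 , r) = Rec (decodeF f (proj₁ (unpair r))) (decodeF f (proj₂ (unpair r)))
... | (7 , r) = Mu (decodeF f r)
... | (_ , r) = Z

decode : ℕ → Code
decode n = decodeF n n

W : ℕ → ℕ → Set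
W e x = ∃ λ y → decode e ⊢ x ↦ y

Subset : Set₁
Subset = ℕ → Set

_≐_ : Subset → Subset → Set
A ≐ B = ∀ x → (A x → B x) × (B x → A x)

IsREset : Subset → Set
IsREset A = ∃ λ e → A ≐ W e

IsRErel : (ℕ → ℕ → Set) → Set
IsRErel η = ∃ λ e → ∀ x y → (η x y → W e ⟪ x , y ⟫) × (W e ⟪ x , y ⟫ → η x y)

record Positive (η : ℕ → ℕ → Set) : Set where
  field
    isEquivalence  : IsEquivalence η
    isRE           : IsRErel η
    infiniteClasses : ∀ (l : List ℕ) → ∃ λ x → ∀ y → y ∈ l → ¬ η x y

module _ (η : ℕ → ℕ → Set) where

  IsMin : ℕ → Set
  IsMin x = ∀ z → z < x → ¬ η z x

  -- IsA k x : x = a_k (the (k+1)-st least class representative)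
  IsA : ℕ → ℕ → Set
  IsA zero    x = IsMin x × (∀ z → z < x → ¬ IsMin z)
  IsA (suc k) x = IsMin x × ∃ λ y → IsA k y × y < x ×
                  (∀ z → y < z → z < x → ¬ IsMin z)

  Aset : ℕ → Subset
  Aset n x = ∃ λ k → k < n × ∃ λ y → IsA k y × η x y

  Closed : Subset → Set
  Closed L = ∀ x y → η x y → L x → L y

  -- hypothesis e denotes the η-closure of W_e
  Hyp : ℕ → Subset
  Hyp e x = ∃ λ y → η x y × W e y

Family : Set₁
Family = Subset → Set

IsηFamily : (ℕ → ℕ → Set) → Family → Set₁
IsηFamily η 𝒞 = ∃ λ (e : ℕ) →
  let B : ℕ → Subset
      B k x = W e ⟪ k , x ⟫
  in (∀ k → Closed η (B k)) ×
     (∀ i j → i ≢ j → ¬ (B i ≐ B j)) ×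
     (∀ L → (𝒞 L → ∃ λ k → L ≐ B k) × ((∃ λ k → L ≐ B k) → 𝒞 L))

-- nothing encodes the pause symbol #
Text : (ℕ → Maybe ℕ) → Subset → Set
Text T L = ∀ x → (L x → ∃ λ n → T n ≡ just x) × ((∃ λ n → T n ≡ just x) → L x)

_[_] : (ℕ → Maybe ℕ) → ℕ → List (Maybe ℕ)
T [ n ] = applyUpTo T n

encElem : Maybe ℕ → ℕ
encElem nothing  = zero
encElem (just x) = suc x

encSeq : List (Maybe ℕ) → ℕ
encSeq []      = zero
encSeq (a ∷ l) = suc ⟪ encElem a , encSeq l ⟫

-- outputs: nothing encodes ?
encOut : Maybe ℕ → ℕ
encOut nothing  = zero
encOut (just e) = suc e

Learner : Set
Learner = List (Maybe ℕ) → Maybe ℕ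

Recursive : Learner → Set
Recursive M = ∃ λ m → ∀ σ → decode m ⊢ encSeq σ ↦ encOut (M σ)

ExLearns : (ℕ → ℕ → Set) → Learner → Family → Set₁
ExLearns η M 𝒞 = ∀ L → 𝒞 L → ∀ T → Text T L →
  ∃ λ e → ∃ λ N → (∀ n → N ≤ n → M (T [ n ]) ≡ just e) × (Hyp η e ≐ L)

BcLearns : (ℕ → ℕ → Set) → Learner → Family → Set₁
BcLearns η M 𝒞 = ∀ L → 𝒞 L → ∀ T → Text T L →
  ∃ λ N → ∀ n → N ≤ n → ∃ λ e → M (T [ n ]) ≡ just e × (Hyp η e ≐ L)

-- M(T[n]) converges (possibly to ?)
Converges : Learner → (ℕ → Maybe ℕ) → Set
Converges M T = ∃ λ o → ∃ λ N → ∀ n → N ≤ n → M (T [ n ]) ≡ o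

ExLearnable : (ℕ → ℕ → Set) → Family → Set₁
ExLearnable η 𝒞 = ∃ λ M → Recursive M × ExLearns η M 𝒞

BcLearnable : (ℕ → ℕ → Set) → Family → Set₁
BcLearnable η 𝒞 = ∃ λ M → Recursive M × BcLearns η M 𝒞

ConfLearnable : (ℕ → ℕ → Set) → Family → Set₁
ConfLearnable η 𝒞 = ∃ λ M → Recursive M × ExLearns η M 𝒞 ×
  (∀ (L : Subset) T → Text T L → Converges M T)

𝒜 : (ℕ → ℕ → Set) → Family
𝒜 η L = ∃ λ n → L ≐ Aset η n

𝒜ℕ : (ℕ → ℕ → Set) → Family
𝒜ℕ η L = 𝒜 η L ⊎ (∀ x → L x)

-- Read a finite text σ against the enumeration of η up to a stage |σ|: let z be the least
-- number that looks like the least element of its class but does not occur in σ, and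
-- conjecture A_m, where m counts the apparent class minima below z.  On a text for A_n the
-- apparent minima below a_n are eventually exactly a_0, ..., a_{n-1}, which all occur in the
-- text, while a_n never does; so the conjecture converges to A_n.  Conversely, a learner that
-- identifies every A_{j+1} (in the limit or behaviourally correctly) can be fed longer and
-- longer enumerations of A_1, A_2, ... so that on one text for ℕ it conjectures every A_{j+1}:
-- it changes its mind infinitely often there and never settles on ℕ.  Finally x ∈ A_k iff
-- x η y for some y with at most k class minima ≤ y, and the count of class minima is
-- approximated from above by the enumeration of η, so B_0 = ℕ, B_{k+1} = A_k is a uniformly
-- r.e. numbering.  Classical logic enters through least elements and the minima indicator.

module Submission where

open import Defs
open import Data.Nat
open import Data.Nat.Properties
open import Data.Product
open import Data.Sum using (_⊎_; inj₁; inj₂; [_,_]′)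
open import Data.Empty using (⊥-elim)
open import Data.Unit using (⊤; tt)
open import Data.Maybe using (Maybe; just; nothing)
open import Data.Maybe.Properties using (just-injective)
open import Data.List using (List; []; _∷_; upTo; applyUpTo)
open import Data.List.Membership.Propositional.Properties using (∈-upTo⁺)
open import Relation.Nullary
open import Relation.Binary.PropositionalEquality hiding ([_])
open import Relation.Binary.Structures using (IsEquivalence)
open import Relation.Binary.Definitions using (tri<; tri≈; tri>)
open import Axiom.ExcludedMiddle using (ExcludedMiddle)
open import Level using (0ℓ)

natRec : {A : Set} → A → (ℕ → A → A) → ℕ → A
natRec z s zero    = z
natRec z s (suc n) = s n (natRec z s n)

if0 : ℕ → ℕ → ℕ → ℕ
if0 zero    b c = b
if0 (suc _) b c = c

sign isZero : ℕ → ℕ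
sign n   = if0 n 0 1
isZero n = if0 n 1 0

natRec-cong : {A : Set} {z z′ : A} {s s′ : ℕ → A → A} → z ≡ z′ → (∀ i v → s i v ≡ s′ i v) →
              ∀ n → natRec z s n ≡ natRec z′ s′ n
natRec-cong z≡z′ s≗s′ zero    = z≡z′
natRec-cong {s = s} z≡z′ s≗s′ (suc n) = trans (cong (s n) (natRec-cong z≡z′ s≗s′ n)) (s≗s′ n _)

sumTo : (ℕ → ℕ) → ℕ → ℕ
sumTo f = natRec 0 (λ i v → v + f i)

sumTo-cong : ∀ {f g} n → (∀ i → i < n → f i ≡ g i) → sumTo f n ≡ sumTo g n
sumTo-cong zero    h = refl
sumTo-cong (suc n) h = cong₂ _+_ (sumTo-cong n (λ i i<n → h i (m≤n⇒m≤1+n i<n))) (h n ≤-refl)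

sumTo-mono-≤ : ∀ {f g} n → (∀ i → i < n → f i ≤ g i) → sumTo f n ≤ sumTo g n
sumTo-mono-≤ zero    h = z≤n
sumTo-mono-≤ (suc n) h = +-mono-≤ (sumTo-mono-≤ n (λ i i<n → h i (m≤n⇒m≤1+n i<n))) (h n ≤-refl)

sumTo-monoʳ-≤ : ∀ f {m n} → m ≤ n → sumTo f m ≤ sumTo f n
sumTo-monoʳ-≤ f {m} {n} m≤n with m≤n⇒m<n∨m≡n m≤n
... | inj₂ refl = ≤-refl
sumTo-monoʳ-≤ f {m} {suc n} _ | inj₁ m<1+n =
  ≤-trans (sumTo-monoʳ-≤ f (≤-pred m<1+n)) (m≤m+n (sumTo f n) (f n))

sumTo-zeros : ∀ f {m n} → m ≤ n → (∀ i → m ≤ i → i < n → f i ≡ 0) → sumTo f n ≡ sumTo f m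
sumTo-zeros f {m} {n} m≤n h with m≤n⇒m<n∨m≡n m≤n
... | inj₂ refl = refl
sumTo-zeros f {m} {suc n} _ h | inj₁ m<1+n = begin
  sumTo f n + f n ≡⟨ cong (sumTo f n +_) (h n (≤-pred m<1+n) ≤-refl) ⟩
  sumTo f n + 0   ≡⟨ +-identityʳ _ ⟩
  sumTo f n       ≡⟨ sumTo-zeros f (≤-pred m<1+n) (λ i m≤i i<n → h i m≤i (m≤n⇒m≤1+n i<n)) ⟩
  sumTo f m       ∎
  where open ≡-Reasoning

sumTo-positive : ∀ f {n} i → i < n → 0 < f i → 0 < sumTo f n
sumTo-positive f {suc n} i i<1+n 0<fi with m≤n⇒m<n∨m≡n (≤-pred i<1+n)
... | inj₁ i<n  = ≤-trans (sumTo-positive f i i<n 0<fi) (m≤m+n _ _)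
... | inj₂ refl = ≤-trans 0<fi (m≤n+m _ _)

sumTo-positive⁻¹ : ∀ f n → 0 < sumTo f n → ∃ λ i → i < n × 0 < f i
sumTo-positive⁻¹ f (suc n) 0<sum with f n in eq
... | suc _ = n , ≤-refl , subst (0 <_) (sym eq) z<s
... | zero  = let (i , i<n , 0<fi) = sumTo-positive⁻¹ f n (subst (0 <_) (+-identityʳ _) 0<sum)
              in i , m≤n⇒m≤1+n i<n , 0<fi

sumTo-ones : ∀ f n → (∀ i → i < n → f i ≡ 1) → sumTo f n ≡ n
sumTo-ones f zero    h = refl
sumTo-ones f (suc n) h rewrite sumTo-ones f n (λ i i<n → h i (m≤n⇒m≤1+n i<n)) | h n ≤-refl = +-comm n 1

isZero-positive : ∀ {n} → 0 < n → isZero n ≡ 0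
isZero-positive {suc n} _ = refl

isZero≡0⇒positive : ∀ {n} → isZero n ≡ 0 → 0 < n
isZero≡0⇒positive {suc n} _ = z<s

sign-positive : ∀ {n} → 0 < n → sign n ≡ 1
sign-positive {suc n} _ = refl

sign-positive⁻¹ : ∀ {n} → 0 < sign n → 0 < n
sign-positive⁻¹ {suc n} _ = z<s

eqℕ : ℕ → ℕ → ℕ
eqℕ a b = if0 (a ∸ b) (isZero (b ∸ a)) 0

eqℕ-refl : ∀ a → eqℕ a a ≡ 1
eqℕ-refl a rewrite n∸n≡0 a = refl

eqℕ-positive : ∀ a b → 0 < eqℕ a b → a ≡ b
eqℕ-positive a b p with a ∸ b in e₁
... | zero with b ∸ a in e₂
...   | zero = ≤-antisym (m∸n≡0⇒m≤n e₁) (m∸n≡0⇒m≤n e₂)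
eqℕ-positive a b () | zero | suc _
eqℕ-positive a b () | suc _

-- Counting the i < w at which the partial sums of g still vanish locates the first non-zero of g.
sumTo-zero-prefix : ∀ g {a w} → a ≤ w → (∀ j → j < a → g j ≡ 0) → 0 < g a →
                    sumTo (λ i → isZero (sumTo g (suc i))) w ≡ a
sumTo-zero-prefix g {a} {w} a≤w zeros pos = begin
  sumTo prefixZero w ≡⟨ sumTo-zeros prefixZero a≤w (λ i a≤i _ → isZero-positive (sumTo-positive g a (s≤s a≤i) pos)) ⟩
  sumTo prefixZero a ≡⟨ sumTo-ones prefixZero a (λ i i<a → cong isZero (prefix i i<a)) ⟩
  a                  ∎
  where
  open ≡-Reasoning
  prefixZero : ℕ → ℕ
  prefixZero i = isZero (sumTo g (suc i))
  prefix : ∀ i → i < a → sumTo g (suc i) ≡ 0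
  prefix i i<a = sumTo-zeros g z≤n (λ j _ j<1+i → zeros j (≤-trans j<1+i i<a))

Eventually : (ℕ → Set) → Set
Eventually P = ∃ λ t → ∀ s → t ≤ s → P s

eventually-× : ∀ {P Q : ℕ → Set} → Eventually P → Eventually Q → Eventually (λ s → P s × Q s)
eventually-× (t , p) (t′ , q) = t ⊔ t′ , λ s t⊔t′≤s →
  p s (≤-trans (m≤m⊔n t t′) t⊔t′≤s) , q s (≤-trans (m≤n⊔m t t′) t⊔t′≤s)

eventually-map : ∀ {P Q : ℕ → Set} → (∀ {s} → P s → Q s) → Eventually P → Eventually Q
eventually-map f (t , p) = t , λ s t≤s → f (p s t≤s)

≐-refl : ∀ {A} → A ≐ A
≐-refl x = (λ a → a) , (λ a → a)

≐-sym : ∀ {A B} → A ≐ B → B ≐ A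
≐-sym A≐B x = proj₂ (A≐B x) , proj₁ (A≐B x)

≐-trans : ∀ {A B C} → A ≐ B → B ≐ C → A ≐ C
≐-trans A≐B B≐C x = (λ a → proj₁ (B≐C x) (proj₁ (A≐B x) a)) , (λ c → proj₂ (A≐B x) (proj₂ (B≐C x) c))

fst snd : ℕ → ℕ
fst n = proj₁ (unpair n)
snd n = proj₂ (unpair n)

pair-sucʳ : ∀ x y → ⟪ x , suc y ⟫ ≡ suc ⟪ suc x , y ⟫
pair-sucʳ x y = begin
  tri (x + suc y) + suc y ≡⟨ cong (λ t → tri t + suc y) (+-suc x y) ⟩
  tri (suc x + y) + suc y ≡⟨ +-suc (tri (suc x + y)) y ⟩
  suc (tri (suc x + y) + y) ∎
  where open ≡-Reasoning

pair-suc-zero : ∀ x → ⟪ suc x , 0 ⟫ ≡ suc ⟪ 0 , x ⟫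
pair-suc-zero x = begin
  tri (suc x + 0) + 0 ≡⟨ +-identityʳ _ ⟩
  tri (suc x + 0)     ≡⟨ cong tri (+-identityʳ (suc x)) ⟩
  suc (x + tri x)     ≡⟨ cong suc (+-comm x (tri x)) ⟩
  suc (tri x + x)     ∎
  where open ≡-Reasoning

unpair-pair : ∀ x y → unpair ⟪ x , y ⟫ ≡ (x , y)
unpair-pair x y = onDiagonal (x + y) x y refl
  where
  onDiagonal : ∀ d x y → x + y ≡ d → unpair ⟪ x , y ⟫ ≡ (x , y)
  onNextDiagonal : ∀ d y x → x + y ≡ suc d → unpair ⟪ x , y ⟫ ≡ (x , y)
  onDiagonal zero    zero zero _ = refl
  onDiagonal (suc d) x    y    e = onNextDiagonal d y x e
  onNextDiagonal d (suc y) x e = trans (cong unpair (pair-sucʳ x y))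
    (cong nextPair (onNextDiagonal d y (suc x) (trans (sym (+-suc x y)) e)))
  onNextDiagonal d zero (suc x) e = trans (cong unpair (pair-suc-zero x))
    (cong nextPair (onDiagonal d 0 x (suc-injective (trans (sym (+-identityʳ (suc x))) e))))

fst-pair : ∀ x y → fst ⟪ x , y ⟫ ≡ x
fst-pair x y = cong proj₁ (unpair-pair x y)

snd-pair : ∀ x y → snd ⟪ x , y ⟫ ≡ y
snd-pair x y = cong proj₂ (unpair-pair x y)

pair-unpair : ∀ n → ⟪ fst n , snd n ⟫ ≡ n
pair-unpair zero = refl
pair-unpair (suc n) with unpair n | pair-unpair n
... | zero  , y | e = trans (pair-suc-zero y) (cong suc e)
... | suc x , y | e = trans (pair-sucʳ x y) (cong suc e)

n≤tri[n] : ∀ n → n ≤ tri n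
n≤tri[n] zero    = z≤n
n≤tri[n] (suc n) = m≤m+n (suc n) (tri n)

m≤⟪m,n⟫ : ∀ m n → m ≤ ⟪ m , n ⟫
m≤⟪m,n⟫ m n = ≤-trans (m≤m+n m n) (≤-trans (n≤tri[n] (m + n)) (m≤m+n _ n))

n≤⟪m,n⟫ : ∀ m n → n ≤ ⟪ m , n ⟫
n≤⟪m,n⟫ m n = m≤n+m n (tri (m + n))

n<⟪1+m,n⟫ : ∀ m n → n < ⟪ suc m , n ⟫
n<⟪1+m,n⟫ m n = +-monoˡ-≤ n (s≤s z≤n)

data PR : Set where
  pz ps pfst psnd : PR
  pcomp ppair prec : PR → PR → PR

primRec : (ℕ → ℕ) → (ℕ → ℕ) → ℕ → ℕ → ℕ
primRec f g u = natRec (f u) (λ y v → g ⟪ ⟪ u , y ⟫ , v ⟫)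

evalPR : PR → ℕ → ℕ
evalPR pz          x = 0
evalPR ps          x = suc x
evalPR pfst        x = fst x
evalPR psnd        x = snd x
evalPR (pcomp f g) x = evalPR f (evalPR g x)
evalPR (ppair f g) x = ⟪ evalPR f x , evalPR g x ⟫
evalPR (prec f g)  x = primRec (evalPR f) (evalPR g) (fst x) (snd x)

toCode : PR → Code
toCode pz          = Z
toCode ps          = S
toCode pfst        = Fst
toCode psnd        = Snd
toCode (pcomp f g) = Comp (toCode f) (toCode g)
toCode (ppair f g) = Pair (toCode f) (toCode g)
toCode (prec f g)  = Rec (toCode f) (toCode g)

evalPR-prec : ∀ f g u y → evalPR (prec f g) ⟪ u , y ⟫ ≡ primRec (evalPR f) (evalPR g) u y
evalPR-prec f g u y rewrite fst-pair u y | snd-pair u y = refl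

toCode-computes : ∀ p x → toCode p ⊢ x ↦ evalPR p x
toCode-computes pz          x = ev-Z
toCode-computes ps          x = ev-S
toCode-computes pfst        x = subst (λ n → Fst ⊢ n ↦ fst x) (pair-unpair x) (ev-Fst {fst x} {snd x})
toCode-computes psnd        x = subst (λ n → Snd ⊢ n ↦ snd x) (pair-unpair x) (ev-Snd {fst x} {snd x})
toCode-computes (pcomp f g) x = ev-Comp (toCode-computes g x) (toCode-computes f (evalPR g x))
toCode-computes (ppair f g) x = ev-Pair (toCode-computes f x) (toCode-computes g x)
toCode-computes (prec f g)  x = subst (λ n → toCode (prec f g) ⊢ n ↦ evalPR (prec f g) x) (pair-unpair x) (rec (fst x) (snd x))
  where
  rec : ∀ u y → toCode (prec f g) ⊢ ⟪ u , y ⟫ ↦ primRec (evalPR f) (evalPR g) u y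
  rec u zero    = ev-Rec0 {x = u} (toCode-computes f u)
  rec u (suc y) = ev-RecS {x = u} {y = y} (rec u y) (toCode-computes g _)

toCode-functional : ∀ p {x y} → toCode p ⊢ x ↦ y → y ≡ evalPR p x
toCode-functional pz ev-Z = refl
toCode-functional ps ev-S = refl
toCode-functional pfst (ev-Fst {x} {y}) = sym (fst-pair x y)
toCode-functional psnd (ev-Snd {x} {y}) = sym (snd-pair x y)
toCode-functional (pcomp f g) (ev-Comp d e) with toCode-functional g d
... | refl = toCode-functional f e
toCode-functional (ppair f g) (ev-Pair d e) = cong₂ ⟪_,_⟫ (toCode-functional f d) (toCode-functional g e)
toCode-functional (prec f g) (ev-Rec0 {x = u} d) =
  trans (toCode-functional f d) (sym (evalPR-prec f g u 0))
toCode-functional (prec f g) (ev-RecS {x = u} {y = y} d e) = begin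
  _                                                 ≡⟨ toCode-functional g e ⟩
  evalPR g ⟪ ⟪ u , y ⟫ , _ ⟫                          ≡⟨ cong (λ v → evalPR g ⟪ ⟪ u , y ⟫ , v ⟫) (toCode-functional (prec f g) d) ⟩
  evalPR g ⟪ ⟪ u , y ⟫ , evalPR (prec f g) ⟪ u , y ⟫ ⟫ ≡⟨ cong (λ v → evalPR g ⟪ ⟪ u , y ⟫ , v ⟫) (evalPR-prec f g u y) ⟩
  primRec (evalPR f) (evalPR g) u (suc y)             ≡⟨ evalPR-prec f g u (suc y) ⟨
  evalPR (prec f g) ⟪ u , suc y ⟫                     ∎
  where open ≡-Reasoning

idPR : PR
idPR = ppair pfst psnd

idPR-correct : ∀ x → evalPR idPR x ≡ x
idPR-correct = pair-unpair

constPR : ℕ → PR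
constPR zero    = pz
constPR (suc n) = pcomp ps (constPR n)

constPR-correct : ∀ n x → evalPR (constPR n) x ≡ n
constPR-correct zero    x = refl
constPR-correct (suc n) x = cong suc (constPR-correct n x)

predPR : PR
predPR = pcomp (prec pz (pcomp psnd pfst)) (ppair pz idPR)

predPR-correct : ∀ n → evalPR predPR n ≡ pred n
predPR-correct n rewrite evalPR-prec pz (pcomp psnd pfst) 0 (evalPR idPR n) | idPR-correct n with n
... | zero  = refl
... | suc i = trans (cong snd (fst-pair ⟪ 0 , i ⟫ _)) (snd-pair 0 i)

addPR : PR
addPR = prec idPR (pcomp ps psnd)

addPR-correct : ∀ a b → evalPR addPR ⟪ a , b ⟫ ≡ a + b
addPR-correct a b rewrite evalPR-prec idPR (pcomp ps psnd) a b = go b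
  where
  go : ∀ b → primRec (evalPR idPR) (evalPR (pcomp ps psnd)) a b ≡ a + b
  go zero    = trans (idPR-correct a) (sym (+-identityʳ a))
  go (suc b) = trans (cong suc (trans (snd-pair ⟪ a , b ⟫ (primRec (evalPR idPR) (evalPR (pcomp ps psnd)) a b)) (go b)))
                     (sym (+-suc a b))

monusPR : PR
monusPR = prec idPR (pcomp predPR psnd)

monusPR-correct : ∀ a b → evalPR monusPR ⟪ a , b ⟫ ≡ a ∸ b
monusPR-correct a b rewrite evalPR-prec idPR (pcomp predPR psnd) a b = go b
  where
  go : ∀ b → primRec (evalPR idPR) (evalPR (pcomp predPR psnd)) a b ≡ a ∸ b
  go zero    = idPR-correct a
  go (suc b) = begin
    evalPR predPR (snd ⟪ ⟪ a , b ⟫ , r ⟫) ≡⟨ predPR-correct (snd ⟪ ⟪ a , b ⟫ , r ⟫) ⟩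
    pred (snd ⟪ ⟪ a , b ⟫ , r ⟫)          ≡⟨ cong pred (trans (snd-pair ⟪ a , b ⟫ r) (go b)) ⟩
    pred (a ∸ b)                        ≡⟨ pred[m∸n]≡m∸[1+n] a b ⟩
    a ∸ suc b                           ∎
    where open ≡-Reasoning
          r = primRec (evalPR idPR) (evalPR (pcomp predPR psnd)) a b

data Expr : Set where
  var    : ℕ → Expr
  app    : PR → Expr → Expr
  epair  : Expr → Expr → Expr
  nrec   : Expr → Expr → Expr → Expr
  ifz    : Expr → Expr → Expr → Expr
  bsum   : Expr → Expr → Expr
  emonus : Expr → Expr → Expr
  elet   : Expr → Expr → Expr

look : ℕ → List ℕ → ℕ
look i       []      = 0
look zero    (v ∷ ρ) = v
look (suc i) (v ∷ ρ) = look i ρ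

evalE : Expr → List ℕ → ℕ
evalE (var i)      ρ = look i ρ
evalE (app p e)    ρ = evalPR p (evalE e ρ)
evalE (epair a b)  ρ = ⟪ evalE a ρ , evalE b ρ ⟫
evalE (nrec n b s) ρ = natRec (evalE b ρ) (λ i v → evalE s (v ∷ i ∷ ρ)) (evalE n ρ)
evalE (ifz a b c)  ρ = if0 (evalE a ρ) (evalE b ρ) (evalE c ρ)
evalE (bsum n b)   ρ = sumTo (λ i → evalE b (i ∷ ρ)) (evalE n ρ)
evalE (emonus a b) ρ = evalE a ρ ∸ evalE b ρ
evalE (elet a b)   ρ = evalE b (evalE a ρ ∷ ρ)

encEnv : List ℕ → ℕ
encEnv []      = 0
encEnv (v ∷ ρ) = ⟪ encEnv ρ , v ⟫

varPR : ℕ → PR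
varPR zero    = psnd
varPR (suc i) = pcomp (varPR i) pfst

varPR-correct : ∀ i ρ → evalPR (varPR i) (encEnv ρ) ≡ look i ρ
varPR-correct zero    []      = refl
varPR-correct (suc i) []      = varPR-correct i []
varPR-correct zero    (v ∷ ρ) = snd-pair (encEnv ρ) v
varPR-correct (suc i) (v ∷ ρ) rewrite fst-pair (encEnv ρ) v = varPR-correct i ρ

compileE : Expr → PR
compileE (var i)      = varPR i
compileE (app p e)    = pcomp p (compileE e)
compileE (epair a b)  = ppair (compileE a) (compileE b)
compileE (nrec n b s) = pcomp (prec (compileE b) (compileE s)) (ppair idPR (compileE n))
compileE (ifz a b c)  = pcomp (prec (compileE b) (pcomp (compileE c) (pcomp pfst pfst))) (ppair idPR (compileE a))
compileE (bsum n b)   = pcomp (prec pz (pcomp addPR (ppair psnd (pcomp (compileE b) pfst)))) (ppair idPR (compileE n))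
compileE (emonus a b) = pcomp monusPR (ppair (compileE a) (compileE b))
compileE (elet a b)   = pcomp (compileE b) (ppair idPR (compileE a))

-- Step i of a recursion over encEnv ρ sees ⟪ ⟪ encEnv ρ , i ⟫ , v ⟫, which is encEnv (v ∷ i ∷ ρ).
evalPR-prec-env : ∀ f g ρ n → evalPR (pcomp (prec f g) (ppair idPR n)) (encEnv ρ) ≡
                  natRec (evalPR f (encEnv ρ)) (λ i v → evalPR g (encEnv (v ∷ i ∷ ρ))) (evalPR n (encEnv ρ))
evalPR-prec-env f g ρ n rewrite idPR-correct (encEnv ρ) = evalPR-prec f g (encEnv ρ) (evalPR n (encEnv ρ))

compileE-correct : ∀ e ρ → evalPR (compileE e) (encEnv ρ) ≡ evalE e ρ
compileE-correct (var i)      ρ = varPR-correct i ρ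
compileE-correct (app p e)    ρ = cong (evalPR p) (compileE-correct e ρ)
compileE-correct (epair a b)  ρ = cong₂ ⟪_,_⟫ (compileE-correct a ρ) (compileE-correct b ρ)
compileE-correct (nrec n b s) ρ =
  trans (evalPR-prec-env (compileE b) (compileE s) ρ (compileE n))
        (trans (natRec-cong (compileE-correct b ρ) (λ i v → compileE-correct s (v ∷ i ∷ ρ)) (evalPR (compileE n) (encEnv ρ)))
               (cong (natRec (evalE b ρ) (λ i v → evalE s (v ∷ i ∷ ρ))) (compileE-correct n ρ)))
compileE-correct (ifz a b c)  ρ
  rewrite evalPR-prec-env (compileE b) (pcomp (compileE c) (pcomp pfst pfst)) ρ (compileE a)
        | compileE-correct a ρ with evalE a ρ
... | zero  = compileE-correct b ρ
... | suc k rewrite fst-pair ⟪ encEnv ρ , k ⟫ (natRec (evalPR (compileE b) (encEnv ρ))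
                      (λ i v → evalPR (compileE c) (fst (fst (encEnv (v ∷ i ∷ ρ))))) k)
                  | fst-pair (encEnv ρ) k = compileE-correct c ρ
compileE-correct (bsum n b)   ρ =
  trans (evalPR-prec-env pz (pcomp addPR (ppair psnd (pcomp (compileE b) pfst))) ρ (compileE n))
        (trans (natRec-cong refl step (evalPR (compileE n) (encEnv ρ)))
               (cong (sumTo (λ i → evalE b (i ∷ ρ))) (compileE-correct n ρ)))
  where
  step : ∀ i v → evalPR (pcomp addPR (ppair psnd (pcomp (compileE b) pfst))) (encEnv (v ∷ i ∷ ρ))
                 ≡ v + evalE b (i ∷ ρ)
  step i v rewrite snd-pair ⟪ encEnv ρ , i ⟫ v | fst-pair ⟪ encEnv ρ , i ⟫ v =
    trans (addPR-correct v _) (cong (v +_) (compileE-correct b (i ∷ ρ)))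
compileE-correct (emonus a b) ρ =
  trans (monusPR-correct (evalPR (compileE a) (encEnv ρ)) (evalPR (compileE b) (encEnv ρ))) (cong₂ _∸_ (compileE-correct a ρ) (compileE-correct b ρ))
compileE-correct (elet a b)   ρ rewrite idPR-correct (encEnv ρ) | compileE-correct a ρ =
  compileE-correct b (evalE a ρ ∷ ρ)

toPR : Expr → PR
toPR e = pcomp (compileE e) (ppair pz idPR)

toPR-correct : ∀ e n → evalPR (toPR e) n ≡ evalE e (n ∷ [])
toPR-correct e n rewrite idPR-correct n = compileE-correct e (n ∷ [])

zE oneE : Expr
zE   = app pz (var 0)
oneE = app ps zE

sucE fstE sndE predE signE isZeroE : Expr → Expr
sucE  = app ps
fstE  = app pfst
sndE  = app psnd
predE = app predPR
signE e = ifz e zE oneE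
isZeroE e = ifz e oneE zE

constE : ℕ → Expr
constE n = app (constPR n) zE

-- Abstract so that the Gödel numbers of concrete codes are never normalised.
abstract
  encode : Code → ℕ
  encode Z          = 0
  encode S          = ⟪ 1 , 0 ⟫
  encode Fst        = ⟪ 2 , 0 ⟫
  encode Snd        = ⟪ 3 , 0 ⟫
  encode (Comp f g) = ⟪ 4 , ⟪ encode f , encode g ⟫ ⟫
  encode (Pair f g) = ⟪ 5 , ⟪ encode f , encode g ⟫ ⟫
  encode (Rec f g)  = ⟪ 6 , ⟪ encode f , encode g ⟫ ⟫
  encode (Mu f)     = ⟪ 7 , encode f ⟫

  private
    left≤ : ∀ k a b f → ⟪ suc k , ⟪ a , b ⟫ ⟫ ≤ suc f → a ≤ f
    left≤ k a b f le = ≤-pred (≤-trans (s≤s (m≤⟪m,n⟫ a b)) (≤-trans (n<⟪1+m,n⟫ k ⟪ a , b ⟫) le))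

    right≤ : ∀ k a b f → ⟪ suc k , ⟪ a , b ⟫ ⟫ ≤ suc f → b ≤ f
    right≤ k a b f le = ≤-pred (≤-trans (s≤s (n≤⟪m,n⟫ a b)) (≤-trans (n<⟪1+m,n⟫ k ⟪ a , b ⟫) le))

    ⟪1+m,n⟫≰0 : ∀ m n → ¬ ⟪ suc m , n ⟫ ≤ 0
    ⟪1+m,n⟫≰0 m n le = n≮0 (≤-trans (n<⟪1+m,n⟫ m n) le)

    decodeF-encode : ∀ f c → encode c ≤ f → decodeF f (encode c) ≡ c
    decodeF-encode zero    Z _ = refl
    decodeF-encode (suc f) Z _ = refl
    decodeF-encode (suc f) S _ = refl
    decodeF-encode (suc f) Fst _ = refl
    decodeF-encode (suc f) Snd _ = refl
    decodeF-encode zero S ()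
    decodeF-encode zero Fst ()
    decodeF-encode zero Snd ()
    decodeF-encode zero (Comp a b) le = ⊥-elim (⟪1+m,n⟫≰0 3 ⟪ encode a , encode b ⟫ le)
    decodeF-encode zero (Pair a b) le = ⊥-elim (⟪1+m,n⟫≰0 4 ⟪ encode a , encode b ⟫ le)
    decodeF-encode zero (Rec a b)  le = ⊥-elim (⟪1+m,n⟫≰0 5 ⟪ encode a , encode b ⟫ le)
    decodeF-encode zero (Mu a)     le = ⊥-elim (⟪1+m,n⟫≰0 6 (encode a) le)
    decodeF-encode (suc f) (Comp a b) le rewrite unpair-pair 4 ⟪ encode a , encode b ⟫ | unpair-pair (encode a) (encode b) =
      cong₂ Comp (decodeF-encode f a (left≤ 3 (encode a) (encode b) f le)) (decodeF-encode f b (right≤ 3 (encode a) (encode b) f le))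
    decodeF-encode (suc f) (Pair a b) le rewrite unpair-pair 5 ⟪ encode a , encode b ⟫ | unpair-pair (encode a) (encode b) =
      cong₂ Pair (decodeF-encode f a (left≤ 4 (encode a) (encode b) f le)) (decodeF-encode f b (right≤ 4 (encode a) (encode b) f le))
    decodeF-encode (suc f) (Rec a b)  le rewrite unpair-pair 6 ⟪ encode a , encode b ⟫ | unpair-pair (encode a) (encode b) =
      cong₂ Rec (decodeF-encode f a (left≤ 5 (encode a) (encode b) f le)) (decodeF-encode f b (right≤ 5 (encode a) (encode b) f le))
    decodeF-encode (suc f) (Mu a)     le rewrite unpair-pair 7 (encode a) =
      cong Mu (decodeF-encode f a (≤-pred (≤-trans (n<⟪1+m,n⟫ 6 (encode a)) le)))

  decode-encode : ∀ c → decode (encode c) ≡ c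
  decode-encode c = decodeF-encode (encode c) c ≤-refl

  encode-Comp : ∀ f g → encode (Comp f g) ≡ ⟪ 4 , ⟪ encode f , encode g ⟫ ⟫
  encode-Comp f g = refl

  encode-Pair : ∀ f g → encode (Pair f g) ≡ ⟪ 5 , ⟪ encode f , encode g ⟫ ⟫
  encode-Pair f g = refl

  encode-S : encode S ≡ ⟪ 1 , 0 ⟫
  encode-S = refl

  encode-Z : encode Z ≡ 0
  encode-Z = refl

W-encode : ∀ c x → W (encode c) x → ∃ λ y → c ⊢ x ↦ y
W-encode c x (y , d) = y , subst (λ c → c ⊢ x ↦ y) (decode-encode c) d

decode-encode-⊢ : ∀ {c x y} → c ⊢ x ↦ y → decode (encode c) ⊢ x ↦ y
decode-encode-⊢ {c} {x} {y} = subst (λ c → c ⊢ x ↦ y) (sym (decode-encode c))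

encode-W : ∀ c x y → c ⊢ x ↦ y → W (encode c) x
encode-W c x y d = y , decode-encode-⊢ d

-- Clocked evaluation.  run s c x is suc y when c maps x to y with every unbounded search
-- inspecting fewer than s candidates, and 0 when no value is found within this budget.

bind : ℕ → (ℕ → ℕ) → ℕ
bind zero    h = 0
bind (suc y) h = h y

both : ℕ → ℕ → ℕ
both (suc a) (suc b) = suc ⟪ a , b ⟫
both _       _       = 0

-- State of an unbounded search after i candidates: 0 while all candidates returned a
-- positive value, suc (suc y) once y was the first root, 1 if a candidate ran out of budget.
muStep : ℕ → ℕ → ℕ → ℕ
muStep (suc st) r             i = suc st
muStep zero     zero          i = 1
muStep zero     (suc zero)    i = suc (suc i)
muStep zero     (suc (suc _)) i = 0

run : ℕ → Code → ℕ → ℕ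
runRec : ℕ → Code → Code → ℕ → ℕ → ℕ
runMu : ℕ → Code → ℕ → ℕ → ℕ
run s Z          x = 1
run s S          x = suc (suc x)
run s Fst        x = suc (fst x)
run s Snd        x = suc (snd x)
run s (Comp f g) x = bind (run s g x) (run s f)
run s (Pair f g) x = both (run s f x) (run s g x)
run s (Rec f g)  x = runRec s f g (fst x) (snd x)
run s (Mu f)     x = pred (runMu s f x s)
runRec s f g u zero    = run s f u
runRec s f g u (suc y) = bind (runRec s f g u y) (λ z → run s g ⟪ ⟪ u , y ⟫ , z ⟫)
runMu s f x zero    = 0
runMu s f x (suc i) = muStep (runMu s f x i) (run s f ⟪ x , i ⟫) i

PositiveBelow : ℕ → Code → ℕ → ℕ → Set
PositiveBelow s f x y = ∀ k → k < y → ∃ λ v → run s f ⟪ x , k ⟫ ≡ suc (suc v)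

run-sound : ∀ s c x y → run s c x ≡ suc y → c ⊢ x ↦ y
runRec-sound : ∀ s f g u y v → runRec s f g u y ≡ suc v → Rec f g ⊢ ⟪ u , y ⟫ ↦ v
runMu-searching : ∀ s f x i → runMu s f x i ≡ 0 → PositiveBelow s f x i
runMu-found : ∀ s f x i y → runMu s f x i ≡ suc (suc y) →
  y < i × run s f ⟪ x , y ⟫ ≡ 1 × PositiveBelow s f x y

run-sound s Z x y refl = ev-Z
run-sound s S x y refl = ev-S
run-sound s Fst x y refl = subst (λ n → Fst ⊢ n ↦ fst x) (pair-unpair x) (ev-Fst {fst x} {snd x})
run-sound s Snd x y refl = subst (λ n → Snd ⊢ n ↦ snd x) (pair-unpair x) (ev-Snd {fst x} {snd x})
run-sound s (Comp f g) x y e with run s g x in eq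
... | suc m = ev-Comp (run-sound s g x m eq) (run-sound s f m y e)
run-sound s (Pair f g) x y e with run s f x in eq1 | run s g x in eq2
... | suc a | suc b with e
... | refl = ev-Pair (run-sound s f x a eq1) (run-sound s g x b eq2)
run-sound s (Rec f g) x y e = subst (λ n → Rec f g ⊢ n ↦ y) (pair-unpair x) (runRec-sound s f g (fst x) (snd x) y e)
run-sound s (Mu f) x y e with runMu s f x s in eq
... | suc (suc y') with e
... | refl with runMu-found s f x s y eq
... | _ , e1 , h = ev-Mu (run-sound s f ⟪ x , y ⟫ 0 e1) (λ k k<y → let (v , ev) = h k k<y in v , run-sound s f ⟪ x , k ⟫ (suc v) ev)

runRec-sound s f g u zero v e = ev-Rec0 {x = u} (run-sound s f u v e)
runRec-sound s f g u (suc y) v e with runRec s f g u y in eq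
... | suc z = ev-RecS {x = u} {y = y} (runRec-sound s f g u y z eq) (run-sound s g _ v e)

runMu-searching s f x (suc i) e k k<i with runMu s f x i in eq | run s f ⟪ x , i ⟫ in eq2
... | zero | suc (suc v) with m≤n⇒m<n∨m≡n (≤-pred k<i)
... | inj₁ k<i' = runMu-searching s f x i eq k k<i'
... | inj₂ refl = v , eq2
runMu-searching s f x (suc i) () k k<i | zero | zero
runMu-searching s f x (suc i) () k k<i | zero | suc zero
runMu-searching s f x (suc i) () k k<i | suc _ | _

runMu-found s f x (suc i) y e with runMu s f x i in eq | run s f ⟪ x , i ⟫ in eq2
... | suc (suc y') | _ with e
... | refl = let (a , b , c) = runMu-found s f x i y eq in m≤n⇒m≤1+n a , b , c
runMu-found s f x (suc i) y e | zero | suc zero with e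
... | refl = ≤-refl , eq2 , runMu-searching s f x i eq
runMu-found s f x (suc i) y () | zero | zero
runMu-found s f x (suc i) y () | zero | suc (suc _)
runMu-found s f x (suc i) y () | suc zero | _

runMu-below : ∀ s f x y → PositiveBelow s f x y →
  ∀ i → i ≤ y → runMu s f x i ≡ 0
runMu-below s f x y h zero _ = refl
runMu-below s f x y h (suc i) i<y rewrite runMu-below s f x y h i (≤-trans (n≤1+n i) i<y)
  | proj₂ (h i i<y) = refl

runMu-stable : ∀ s f x y → run s f ⟪ x , y ⟫ ≡ 1 → PositiveBelow s f x y →
  ∀ i → y < i → runMu s f x i ≡ suc (suc y)
runMu-stable s f x y e1 h (suc i) y<i with m≤n⇒m<n∨m≡n (≤-pred y<i)
... | inj₁ y<i' rewrite runMu-stable s f x y e1 h i y<i' = refl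
... | inj₂ refl rewrite runMu-below s f x y h y ≤-refl | e1 = refl

pred≡1+y⇒≡2+y : ∀ m y → pred m ≡ suc y → m ≡ suc (suc y)
pred≡1+y⇒≡2+y (suc m) y refl = refl

run-mono : ∀ {s s'} → s ≤ s' → ∀ c x y → run s c x ≡ suc y → run s' c x ≡ suc y
PositiveBelow-mono : ∀ {s s'} → s ≤ s' → ∀ {f x y} → PositiveBelow s f x y → PositiveBelow s' f x y
runRec-mono : ∀ {s s'} → s ≤ s' → ∀ f g u y v → runRec s f g u y ≡ suc v → runRec s' f g u y ≡ suc v
run-mono le Z x y e = e
run-mono le S x y e = e
run-mono le Fst x y e = e
run-mono le Snd x y e = e
run-mono {s} {s'} le (Comp f g) x y e with run s g x in eq
... | suc m rewrite run-mono le g x m eq = run-mono le f m y e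
run-mono {s} {s'} le (Pair f g) x y e with run s f x in eq1 | run s g x in eq2
... | suc a | suc b rewrite run-mono le f x a eq1 | run-mono le g x b eq2 = e
run-mono le (Rec f g) x y e = runRec-mono le f g (fst x) (snd x) y e
run-mono {s} {s'} le (Mu f) x y e with runMu-found s f x s y (pred≡1+y⇒≡2+y _ y e)
... | y<s , e1 , h rewrite runMu-stable s' f x y (run-mono le f _ 0 e1) (PositiveBelow-mono le {f} {x} h) s' (≤-trans y<s le) = refl
PositiveBelow-mono le {f} {x} h k k<y = let (v , ev) = h k k<y in v , run-mono le f ⟪ x , k ⟫ (suc v) ev

runRec-mono le f g u zero v e = run-mono le f u v e
runRec-mono {s} {s'} le f g u (suc y) v e with runRec s f g u y in eq
... | suc z rewrite runRec-mono le f g u y z eq = run-mono le g _ v e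

run-complete : ∀ {c x y} → c ⊢ x ↦ y → ∃ λ s → run s c x ≡ suc y
run-complete-below : ∀ {f x y} → (∀ k → k < y → Σ ℕ λ v → f ⊢ ⟪ x , k ⟫ ↦ suc v) →
  ∀ n → n ≤ y → ∃ λ s → PositiveBelow s f x n
run-complete ev-Z = 0 , refl
run-complete ev-S = 0 , refl
run-complete (ev-Fst {x} {y}) = 0 , cong suc (fst-pair x y)
run-complete (ev-Snd {x} {y}) = 0 , cong suc (snd-pair x y)
run-complete (ev-Comp {f} {g} {x} {y} d e) with run-complete d | run-complete e
... | s1 , e1 | s2 , e2 = s1 ⊔ s2 , converges
  where
  converges : bind (run (s1 ⊔ s2) g x) (run (s1 ⊔ s2) f) ≡ suc _
  converges rewrite run-mono (m≤m⊔n s1 s2) g x y e1 = run-mono (m≤n⊔m s1 s2) f y _ e2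
run-complete (ev-Pair {f} {g} {x} d e) with run-complete d | run-complete e
... | s1 , e1 | s2 , e2 = s1 ⊔ s2 , converges
  where
  converges : both (run (s1 ⊔ s2) f x) (run (s1 ⊔ s2) g x) ≡ suc _
  converges rewrite run-mono (m≤m⊔n s1 s2) f x _ e1 | run-mono (m≤n⊔m s1 s2) g x _ e2 = refl
run-complete (ev-Rec0 {f} {g} {x} d) with run-complete d
... | s , e rewrite fst-pair x 0 | snd-pair x 0 = s , e
run-complete (ev-RecS {f} {g} {x} {y} {z} d e) with run-complete d | run-complete e
... | s1 , e1 | s2 , e2 rewrite fst-pair x (suc y) | snd-pair x (suc y) | fst-pair x y | snd-pair x y
  = s1 ⊔ s2 , converges
  where
  converges : bind (runRec (s1 ⊔ s2) f g x y) (λ z₁ → run (s1 ⊔ s2) g ⟪ ⟪ x , y ⟫ , z₁ ⟫) ≡ suc _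
  converges rewrite runRec-mono (m≤m⊔n s1 s2) f g x y z e1 = run-mono (m≤n⊔m s1 s2) g _ _ e2
run-complete (ev-Mu {f} {x} {y} d h) with run-complete d | run-complete-below {f} {x} h y ≤-refl
... | s1 , e1 | s2 , h2 = s , cong pred (runMu-stable s f x y (run-mono le1 f ⟪ x , y ⟫ 0 e1)
       (PositiveBelow-mono le2 {f} {x} h2) s le3)
  where
  s = s1 ⊔ s2 ⊔ suc y
  le1 : s1 ≤ s
  le1 = ≤-trans (m≤m⊔n s1 s2) (m≤m⊔n (s1 ⊔ s2) (suc y))
  le2 : s2 ≤ s
  le2 = ≤-trans (m≤n⊔m s1 s2) (m≤m⊔n (s1 ⊔ s2) (suc y))
  le3 : y < s
  le3 = m≤n⊔m (s1 ⊔ s2) (suc y)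
run-complete-below h zero _ = 0 , λ k ()
run-complete-below {f} {x} {y} h (suc n) n<y with run-complete-below {f} {x} h n (≤-trans (n≤1+n n) n<y) | h n n<y
... | s1 , h1 | v , d with run-complete d
... | s2 , e2 = s1 ⊔ s2 , λ k k<n → converges k (m≤n⇒m<n∨m≡n (≤-pred k<n))
  where
  converges : ∀ k → (k < n) ⊎ (k ≡ n) → Σ ℕ λ w → run (s1 ⊔ s2) f ⟪ x , k ⟫ ≡ suc (suc w)
  converges k (inj₁ k<n) = let (w , ew) = h1 k k<n in w , run-mono (m≤m⊔n s1 s2) f ⟪ x , k ⟫ _ ew
  converges k (inj₂ refl) = v , run-mono (m≤n⊔m s1 s2) f ⟪ x , n ⟫ _ e2

runPR : Code → PR
runE : Code → Expr
runRecBaseE runRecStepE runMuStepE : Code → Expr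
runPR c = toPR (runE c)
runE Z          = sucE zE
runE S          = sucE (sucE (fstE (var 0)))
runE Fst        = sucE (fstE (fstE (var 0)))
runE Snd        = sucE (sndE (fstE (var 0)))
runE (Comp f g) = ifz (app (runPR g) (var 0)) zE (app (runPR f) (epair (predE (app (runPR g) (var 0))) (sndE (var 0))))
runE (Pair f g) = ifz (app (runPR f) (var 0)) zE (ifz (app (runPR g) (var 0)) zE
                    (sucE (epair (predE (app (runPR f) (var 0))) (predE (app (runPR g) (var 0))))))
runE (Rec f g)  = nrec (sndE (fstE (var 0))) (runRecBaseE f) (runRecStepE g)
runE (Mu f)     = predE (nrec (sndE (var 0)) zE (runMuStepE f))
runRecBaseE f = app (runPR f) (epair (fstE (fstE (var 0))) (sndE (var 0)))
runRecStepE g = ifz (var 0) zE (app (runPR g) (epair (epair (epair (fstE (fstE (var 2))) (var 1)) (predE (var 0))) (sndE (var 2))))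
runMuStepE f  = ifz (var 0) (ifz R (sucE zE) (ifz (predE R) (sucE (sucE (var 1))) zE)) (var 0)
  where R = app (runPR f) (epair (epair (fstE (var 2)) (var 1)) (sndE (var 2)))

runPR-correct : ∀ c x s → evalPR (runPR c) ⟪ x , s ⟫ ≡ run s c x
runE-correct : ∀ c x s → evalE (runE c) (⟪ x , s ⟫ ∷ []) ≡ run s c x
runPR-correct c x s = trans (toPR-correct (runE c) ⟪ x , s ⟫) (runE-correct c x s)
runE-correct Z x s = refl
runE-correct S x s rewrite fst-pair x s = refl
runE-correct Fst x s rewrite fst-pair x s = refl
runE-correct Snd x s rewrite fst-pair x s = refl
runE-correct (Comp f g) x s rewrite runPR-correct g x s | snd-pair x s | predPR-correct (run s g x) with run s g x
... | zero  = refl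
... | suc m = runPR-correct f m s
runE-correct (Pair f g) x s
  rewrite runPR-correct g x s | runPR-correct f x s | predPR-correct (run s g x) | predPR-correct (run s f x)
  with run s f x | run s g x
... | zero  | _     = refl
... | suc a | zero  = refl
... | suc a | suc b = refl
runE-correct (Rec f g) x s = trans (cong iteration (cong snd (fst-pair x s))) (go (snd x))
  where
  ρ = ⟪ x , s ⟫ ∷ []
  iteration : ℕ → ℕ
  iteration = natRec (evalE (runRecBaseE f) ρ) (λ j v → evalE (runRecStepE g) (v ∷ j ∷ ρ))
  go : ∀ i → iteration i ≡ runRec s f g (fst x) i
  go zero rewrite fst-pair x s | snd-pair x s = runPR-correct f (fst x) s
  go (suc i) rewrite go i | fst-pair x s | snd-pair x s | predPR-correct (runRec s f g (fst x) i)
    with runRec s f g (fst x) i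
  ... | zero  = refl
  ... | suc z = runPR-correct g ⟪ ⟪ fst x , i ⟫ , z ⟫ s
runE-correct (Mu f) x s = trans (predPR-correct (search (snd ⟪ x , s ⟫))) (cong pred (trans (cong search (snd-pair x s)) (go s)))
  where
  ρ = ⟪ x , s ⟫ ∷ []
  search : ℕ → ℕ
  search = natRec 0 (λ j v → evalE (runMuStepE f) (v ∷ j ∷ ρ))
  go : ∀ i → search i ≡ runMu s f x i
  go zero = refl
  go (suc i) rewrite go i | fst-pair x s | snd-pair x s | runPR-correct f ⟪ x , i ⟫ s | predPR-correct (run s f ⟪ x , i ⟫)
    with runMu s f x i | run s f ⟪ x , i ⟫
  ... | suc st | _           = refl
  ... | zero   | zero        = refl
  ... | zero   | suc zero    = refl
  ... | zero   | suc (suc _) = refl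

tailCode : ℕ → ℕ
tailCode n = snd (pred n)

dropCode : ℕ → ℕ → ℕ
dropCode w = natRec w (λ _ → tailCode)

entryCode : ℕ → ℕ → ℕ
entryCode w i = fst (pred (dropCode w i))

entry : List (Maybe ℕ) → ℕ → ℕ
entry []      i       = 0
entry (a ∷ σ) zero    = encElem a
entry (a ∷ σ) (suc i) = entry σ i

dropCode-suc : ∀ w i → dropCode w (suc i) ≡ dropCode (tailCode w) i
dropCode-suc w zero    = refl
dropCode-suc w (suc i) = cong tailCode (dropCode-suc w i)

dropCode-zero : ∀ i → dropCode 0 i ≡ 0
dropCode-zero zero    = refl
dropCode-zero (suc i) = cong tailCode (dropCode-zero i)

entryCode-encSeq : ∀ σ i → entryCode (encSeq σ) i ≡ entry σ i
entryCode-encSeq []      i rewrite dropCode-zero i = refl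
entryCode-encSeq (a ∷ σ) zero    = fst-pair (encElem a) (encSeq σ)
entryCode-encSeq (a ∷ σ) (suc i) rewrite dropCode-suc (encSeq (a ∷ σ)) i | snd-pair (encElem a) (encSeq σ) =
  entryCode-encSeq σ i

entry-applyUpTo-< : ∀ (T : ℕ → Maybe ℕ) {N i} → i < N → entry (applyUpTo T N) i ≡ encElem (T i)
entry-applyUpTo-< T {suc N} {zero}  _          = refl
entry-applyUpTo-< T {suc N} {suc i} (s≤s i<N) = entry-applyUpTo-< (λ j → T (suc j)) i<N

entry-applyUpTo-≥ : ∀ (T : ℕ → Maybe ℕ) {N i} → N ≤ i → entry (applyUpTo T N) i ≡ 0
entry-applyUpTo-≥ T {zero}  _           = refl
entry-applyUpTo-≥ T {suc N} {suc i} (s≤s N≤i) = entry-applyUpTo-≥ (λ j → T (suc j)) N≤i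

length≤encSeq : ∀ (T : ℕ → Maybe ℕ) N → N ≤ encSeq (T [ N ])
length≤encSeq T zero    = z≤n
length≤encSeq T (suc N) =
  s≤s (≤-trans (length≤encSeq (λ j → T (suc j)) N) (n≤⟪m,n⟫ (encElem (T zero)) (encSeq ((λ j → T (suc j)) [ N ]))))

encElem≡suc : ∀ (m : Maybe ℕ) {z} → encElem m ≡ suc z → m ≡ just z
encElem≡suc (just x) refl = refl

applyUpTo-cong : ∀ {A : Set} {f g : ℕ → A} m → (∀ i → i < m → f i ≡ g i) → applyUpTo f m ≡ applyUpTo g m
applyUpTo-cong zero    h = refl
applyUpTo-cong (suc m) h = cong₂ _∷_ (h 0 z<s) (applyUpTo-cong m (λ i i<m → h (suc i) (s<s i<m)))

module Learnability (lem : ExcludedMiddle 0ℓ) (η : ℕ → ℕ → Set) (pos : Positive η) where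

  open Positive pos using (infiniteClasses; isRE)
  open IsEquivalence (Positive.isEquivalence pos) renaming (refl to η-refl; sym to η-sym; trans to η-trans)

  -- Class minima and the sets A_n

  leastBelow : (P : ℕ → Set) → ∀ n →
    (∃ λ m → m < n × P m × ∀ k → k < m → ¬ P k) ⊎ (∀ k → k < n → ¬ P k)
  leastBelow P zero = inj₂ λ k ()
  leastBelow P (suc n) with leastBelow P n
  ... | inj₁ (m , m<n , pm , below) = inj₁ (m , m≤n⇒m≤1+n m<n , pm , below)
  ... | inj₂ none with lem {P n}
  ...   | yes pn  = inj₁ (n , ≤-refl , pn , none)
  ...   | no ¬pn = inj₂ λ k k<1+n → [ none k , (λ { refl → ¬pn }) ]′ (m≤n⇒m<n∨m≡n (≤-pred k<1+n))

  least : (P : ℕ → Set) → ∀ n → P n → ∃ λ m → P m × m ≤ n × ∀ k → k < m → ¬ P k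
  least P n pn with leastBelow P (suc n)
  ... | inj₁ (m , m<1+n , pm , below) = m , pm , ≤-pred m<1+n , below
  ... | inj₂ none = ⊥-elim (none n ≤-refl pn)

  classMinimum : ∀ x → ∃ λ m → m ≤ x × η m x × IsMin η m
  classMinimum x with least (λ z → η z x) x η-refl
  ... | m , ηmx , m≤x , below = m , m≤x , ηmx , λ z z<m ηzm → below z z<m (η-trans ηzm ηmx)

  minima-≡ : ∀ {a b} → IsMin η a → IsMin η b → η a b → a ≡ b
  minima-≡ {a} {b} min-a min-b ηab with <-cmp a b
  ... | tri< a<b _ _ = ⊥-elim (min-b a a<b ηab)
  ... | tri≈ _ a≡b _ = a≡b
  ... | tri> _ _ b<a = ⊥-elim (min-a b b<a (η-sym ηab))

  IsA⇒IsMin : ∀ {k x} → IsA η k x → IsMin η x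
  IsA⇒IsMin {zero}  (min , _) = min
  IsA⇒IsMin {suc k} (min , _) = min

  IsA-functional : ∀ {k x x′} → IsA η k x → IsA η k x′ → x ≡ x′
  IsA-functional {zero} {x} {x′} (min , first) (min′ , first′) with <-cmp x x′
  ... | tri< x<x′ _ _ = ⊥-elim (first′ x x<x′ min)
  ... | tri≈ _ x≡x′ _ = x≡x′
  ... | tri> _ _ x′<x = ⊥-elim (first x′ x′<x min′)
  IsA-functional {suc k} {x} {x′} (min , y , ay , y<x , gap) (min′ , y′ , ay′ , y′<x′ , gap′)
    with IsA-functional ay ay′
  ... | refl with <-cmp x x′
  ... | tri< x<x′ _ _ = ⊥-elim (gap′ x y<x x<x′ min)
  ... | tri≈ _ x≡x′ _ = x≡x′
  ... | tri> _ _ x′<x = ⊥-elim (gap x′ y′<x′ x′<x min′)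

  IsA-strictMono : ∀ {j k y x} → IsA η j y → IsA η k x → j < k → y < x
  IsA-strictMono {j} {suc k} ay (_ , y′ , ay′ , y′<x , _) j<1+k with m≤n⇒m<n∨m≡n (≤-pred j<1+k)
  ... | inj₁ j<k  = <-trans (IsA-strictMono ay ay′ j<k) y′<x
  ... | inj₂ refl rewrite IsA-functional ay ay′ = y′<x

  index≤IsA : ∀ {k x} → IsA η k x → k ≤ x
  index≤IsA {zero}  _ = z≤n
  index≤IsA {suc k} (_ , y , ay , y<x , _) = ≤-trans (s≤s (index≤IsA ay)) y<x

  -- a_{k+1} is the least minimum above a_k; it exists because some class avoids [a_0], ..., [a_k].
  a-exists : ∀ k → ∃ λ x → IsA η k x
  a-exists zero = 0 , (λ z ()) , (λ z ())
  a-exists (suc k) with a-exists k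
  ... | y , ay with infiniteClasses (upTo (suc y))
  ... | x , x≁upTo with classMinimum x
  ... | m , m≤x , ηmx , min-m with least (λ z → IsMin η z × y < z) m (min-m , y<m)
    where
    y<m : y < m
    y<m with m ≤? y
    ... | yes m≤y = ⊥-elim (x≁upTo m (∈-upTo⁺ (s≤s m≤y)) (η-sym ηmx))
    ... | no m≰y = ≰⇒> m≰y
  ... | z , (min-z , y<z) , _ , below = z , min-z , y , ay , y<z , λ z′ y<z′ z′<z min-z′ → below z′ z′<z (min-z′ , y<z′)

  IsMin-below-IsA : ∀ {k a m} → IsA η k a → IsMin η m → m ≤ a → ∃ λ i → i ≤ k × IsA η i m
  IsMin-below-IsA {zero} {a} {m} (min-a , first) min-m m≤a with m≤n⇒m<n∨m≡n m≤a
  ... | inj₁ m<a  = ⊥-elim (first m m<a min-m)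
  ... | inj₂ refl = 0 , z≤n , min-a , first
  IsMin-below-IsA {suc k} {a} {m} (min-a , y , ay , y<a , gap) min-m m≤a with m≤n⇒m<n∨m≡n m≤a
  ... | inj₂ refl = suc k , ≤-refl , min-a , y , ay , y<a , gap
  ... | inj₁ m<a with m ≤? y
  ...   | yes m≤y = let (i , i≤k , ai) = IsMin-below-IsA ay min-m m≤y in i , m≤n⇒m≤1+n i≤k , ai
  ...   | no m≰y = ⊥-elim (gap m (≰⇒> m≰y) m<a min-m)

  IsMin⇒IsA : ∀ {m} → IsMin η m → ∃ λ i → i ≤ m × IsA η i m
  IsMin⇒IsA {m} min-m with a-exists m
  ... | a , am = IsMin-below-IsA am min-m (index≤IsA am)

  x∈Aset[1+x] : ∀ x → Aset η (suc x) x
  x∈Aset[1+x] x with classMinimum x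
  ... | m , m≤x , ηmx , min-m with IsMin⇒IsA min-m
  ... | i , i≤m , ai = i , s≤s (≤-trans i≤m m≤x) , m , ai , η-sym ηmx

  Aset-mono : ∀ {j j′ x} → j ≤ j′ → Aset η j x → Aset η j′ x
  Aset-mono j≤j′ (k , k<j , y , ay , ηxy) = k , <-≤-trans k<j j≤j′ , y , ay , ηxy

  IsA⇒∉Aset : ∀ {k x} → IsA η k x → ¬ Aset η k x
  IsA⇒∉Aset {k} {x} ax (j , j<k , y , ay , ηxy) with minima-≡ (IsA⇒IsMin ax) (IsA⇒IsMin ay) ηxy
  ... | refl = <-irrefl refl (IsA-strictMono ay ax j<k)

  IsA⇒∈Aset-suc : ∀ {k x} → IsA η k x → Aset η (suc k) x
  IsA⇒∈Aset-suc ax = _ , ≤-refl , _ , ax , η-refl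

  Aset-closed : ∀ k → Closed η (Aset η k)
  Aset-closed k x y ηxy (j , j<k , z , az , ηxz) = j , j<k , z , az , η-trans (η-sym ηxy) ηxz

  Aset-strictMono : ∀ {j k} → j < k → ¬ (Aset η j ≐ Aset η k)
  Aset-strictMono {j} j<k Aj≐Ak with a-exists j
  ... | a , aj = IsA⇒∉Aset aj (proj₂ (Aj≐Ak a) (Aset-mono j<k (IsA⇒∈Aset-suc aj)))

  Aset≢ℕ : ∀ k → ¬ (∀ x → Aset η k x)
  Aset≢ℕ k all with a-exists k
  ... | a , ak = IsA⇒∉Aset ak (all a)

  -- Approximating the class minima

  ηCode : Code
  ηCode = decode (proj₁ isRE)

  run-ηCode-sound : ∀ {s a b v} → run s ηCode ⟪ a , b ⟫ ≡ suc v → η a b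
  run-ηCode-sound {s} {a} {b} {v} e = proj₂ (proj₂ isRE a b) (v , run-sound s ηCode _ v e)

  η⇒eventually-run : ∀ {a b} → η a b → Eventually (λ s → ∃ λ v → run s ηCode ⟪ a , b ⟫ ≡ suc v)
  η⇒eventually-run {a} {b} ηab with proj₁ (proj₂ isRE a b) ηab
  ... | y , d with run-complete d
  ... | t , e = t , λ s t≤s → y , run-mono t≤s ηCode _ y e

  isMin : ℕ → ℕ
  isMin z with lem {IsMin η z}
  ... | yes _ = 1
  ... | no _  = 0

  isMin-IsMin : ∀ {z} → IsMin η z → isMin z ≡ 1
  isMin-IsMin {z} min with lem {IsMin η z}
  ... | yes _   = refl
  ... | no ¬min = ⊥-elim (¬min min)

  isMin-¬IsMin : ∀ {z} → ¬ IsMin η z → isMin z ≡ 0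
  isMin-¬IsMin {z} ¬min with lem {IsMin η z}
  ... | yes min = ⊥-elim (¬min min)
  ... | no _    = refl

  countMin : ℕ → ℕ
  countMin = sumTo isMin

  countMin-IsA : ∀ {k x} → IsA η k x → countMin x ≡ k
  countMin-IsA {zero}  {x} (_ , first) = sumTo-zeros isMin z≤n (λ i _ i<x → isMin-¬IsMin (first i i<x))
  countMin-IsA {suc k} {x} (_ , y , ay , y<x , gap) = begin
    countMin x             ≡⟨ sumTo-zeros isMin y<x (λ i y<i i<x → isMin-¬IsMin (gap i y<i i<x)) ⟩
    countMin y + isMin y   ≡⟨ cong₂ _+_ (countMin-IsA ay) (isMin-IsMin (IsA⇒IsMin ay)) ⟩
    k + 1                  ≡⟨ +-comm k 1 ⟩
    suc k                  ∎
    where open ≡-Reasoning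

  countMin-suc-IsA : ∀ {k x} → IsA η k x → countMin (suc x) ≡ suc k
  countMin-suc-IsA {k} ax = trans (cong₂ _+_ (countMin-IsA ax) (isMin-IsMin (IsA⇒IsMin ax))) (+-comm k 1)

  IsA⇒index<countMin : ∀ {k x n} → IsA η k x → x < n → k < countMin n
  IsA⇒index<countMin ax x<n = ≤-trans (≤-reflexive (sym (countMin-suc-IsA ax))) (sumTo-monoʳ-≤ isMin x<n)

  -- Stage-s approximations: z looks minimal at stage s unless some pair ⟪ z , z′ ⟫ with z′ < z
  -- has been enumerated into η within s steps.
  ηAt : ℕ → ℕ → ℕ → ℕ
  ηAt s a b = sign (run s ηCode ⟪ a , b ⟫)

  isMinAt : ℕ → ℕ → ℕ
  isMinAt s z = isZero (sumTo (ηAt s z) z)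

  countMinAt : ℕ → ℕ → ℕ
  countMinAt s = sumTo (isMinAt s)

  isMinAt-IsMin : ∀ s {z} → IsMin η z → isMinAt s z ≡ 1
  isMinAt-IsMin s {z} min with sumTo (ηAt s z) z in eq
  ... | zero = refl
  ... | suc _ with sumTo-positive⁻¹ (ηAt s z) z (subst (0 <_) (sym eq) z<s)
  ...   | i , i<z , 0<ηAt with run s ηCode ⟪ z , i ⟫ in eq′
  ...     | suc v = ⊥-elim (min i i<z (η-sym (run-ηCode-sound eq′)))
  isMinAt-IsMin s min | suc _ | i , i<z , () | zero

  isMin≤isMinAt : ∀ s z → isMin z ≤ isMinAt s z
  isMin≤isMinAt s z with lem {IsMin η z}
  ... | yes min = ≤-reflexive (sym (isMinAt-IsMin s min))
  ... | no _    = z≤n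

  countMin≤countMinAt : ∀ s n → countMin n ≤ countMinAt s n
  countMin≤countMinAt s n = sumTo-mono-≤ n (λ i _ → isMin≤isMinAt s i)

  isMinAt-¬IsMin : ∀ {z} → ¬ IsMin η z → Eventually (λ s → isMinAt s z ≡ 0)
  isMinAt-¬IsMin {z} ¬min with lem {∃ λ z′ → z′ < z × η z′ z}
  ... | no none = ⊥-elim (¬min λ z′ z′<z ηz′z → none (z′ , z′<z , ηz′z))
  ... | yes (z′ , z′<z , ηz′z) = eventually-map looksNonMin (η⇒eventually-run (η-sym ηz′z))
    where
    looksNonMin : ∀ {s} → ∃ (λ v → run s ηCode ⟪ z , z′ ⟫ ≡ suc v) → isMinAt s z ≡ 0
    looksNonMin {s} (v , e) = isZero-positive (sumTo-positive (ηAt s z) z′ z′<z (subst (λ r → 0 < sign r) (sym e) z<s))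

  isMinAt-eventually : ∀ z → Eventually (λ s → isMinAt s z ≡ isMin z)
  isMinAt-eventually z with lem {IsMin η z}
  ... | yes min = 0 , λ s _ → isMinAt-IsMin s min
  ... | no ¬min = isMinAt-¬IsMin ¬min

  isMinAt-stabilises : ∀ n → Eventually (λ s → ∀ z → z < n → isMinAt s z ≡ isMin z)
  isMinAt-stabilises zero = 0 , λ s _ z ()
  isMinAt-stabilises (suc n) =
    eventually-map extend (eventually-× (isMinAt-stabilises n) (isMinAt-eventually n))
    where
    extend : ∀ {s} → (∀ z → z < n → isMinAt s z ≡ isMin z) × isMinAt s n ≡ isMin n →
             ∀ z → z < suc n → isMinAt s z ≡ isMin z
    extend (below , at-n) z z<1+n with m≤n⇒m<n∨m≡n (≤-pred z<1+n)
    ... | inj₁ z<n  = below z z<n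
    ... | inj₂ refl = at-n

  countMinAt-stabilises : ∀ n → Eventually (λ s → countMinAt s n ≡ countMin n)
  countMinAt-stabilises n = eventually-map (λ agree → sumTo-cong n agree) (isMinAt-stabilises n)

  -- Expressions whose ℕ arguments are the de Bruijn indices of the stage and the arguments.
  runηE : ℕ → ℕ → ℕ → Expr
  runηE s a b = app (runPR ηCode) (epair (epair (var a) (var b)) (var s))

  isMinAtE : ℕ → ℕ → Expr
  isMinAtE s z = isZeroE (bsum (var z) (signE (runηE (suc s) (suc z) 0)))

  countMinAtE : ℕ → ℕ → Expr
  countMinAtE s n = bsum (var n) (isMinAtE (suc s) 0)

  runηE-correct : ∀ s a b ρ → evalE (runηE s a b) ρ ≡ run (look s ρ) ηCode ⟪ look a ρ , look b ρ ⟫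
  runηE-correct s a b ρ = runPR-correct ηCode _ _

  isMinAtE-correct : ∀ s z ρ → evalE (isMinAtE s z) ρ ≡ isMinAt (look s ρ) (look z ρ)
  isMinAtE-correct s z ρ =
    cong isZero (sumTo-cong (look z ρ) (λ i _ → cong sign (runηE-correct (suc s) (suc z) 0 (i ∷ ρ))))

  countMinAtE-correct : ∀ s n ρ → evalE (countMinAtE s n) ρ ≡ countMinAt (look s ρ) (look n ρ)
  countMinAtE-correct s n ρ = sumTo-cong (look n ρ) (λ i _ → isMinAtE-correct (suc s) 0 (i ∷ ρ))

  -- The η-family 𝒜_η ∪ {ℕ}

  Bset : ℕ → Subset
  Bset zero    x = ⊤
  Bset (suc k) x = Aset η k x

  -- y witnesses x ∈ A_k at stage s.  Since isMinAt s overestimates isMin, the bound on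
  -- countMinAt puts the minimum of [y] among a_0, ..., a_{k-1}; at late stages it is exact.
  witnessAt : ℕ → ℕ → ℕ → ℕ → ℕ
  witnessAt k x s y = if0 (run s ηCode ⟪ x , y ⟫) 0 (isZero (countMinAt s (suc y) ∸ k))

  -- The code of B enumerates ⟪ k , x ⟫ by searching for a root s of searchB k x.
  searchB : ℕ → ℕ → ℕ → ℕ
  searchB zero    x s = 0
  searchB (suc k) x s = isZero (sumTo (witnessAt k x s) s)

  witnessAt-sound : ∀ k x s y → 0 < witnessAt k x s y → Aset η k x
  witnessAt-sound k x s y p with run s ηCode ⟪ x , y ⟫ in eq | countMinAt s (suc y) ∸ k in eq′
  ... | suc v | zero with classMinimum y
  ...   | m , m≤y , ηmy , min-m with IsMin⇒IsA min-m
  ...     | i , _ , ai = i , i<k , m , ai , η-trans (run-ηCode-sound eq) (η-sym ηmy)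
    where
    i<k : i < k
    i<k = ≤-trans (IsA⇒index<countMin ai (s≤s m≤y)) (≤-trans (countMin≤countMinAt s (suc y)) (m∸n≡0⇒m≤n eq′))
  witnessAt-sound k x s y () | zero  | _
  witnessAt-sound k x s y () | suc v | suc _

  searchB-sound : ∀ k x s → searchB k x s ≡ 0 → Bset k x
  searchB-sound zero    x s _ = tt
  searchB-sound (suc k) x s e with sumTo-positive⁻¹ (witnessAt k x s) s (isZero≡0⇒positive e)
  ... | y , _ , p = witnessAt-sound k x s y p

  searchB-complete : ∀ k x → Bset k x → ∃ λ s → searchB k x s ≡ 0
  searchB-complete zero    x _ = 0 , refl
  searchB-complete (suc k) x (j , j<k , y , ay , ηxy)
    with eventually-× (countMinAt-stabilises (suc y)) (eventually-× (η⇒eventually-run ηxy) (suc y , λ _ le → le))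
  ... | t , late = t , isZero-positive (sumTo-positive (witnessAt k x t) y y<t witness)
    where
    y<t : y < t
    y<t = proj₂ (proj₂ (late t ≤-refl))
    witness : 0 < witnessAt k x t y
    witness with late t ≤-refl
    ... | stable , (v , e) , _ rewrite e | stable | countMin-suc-IsA ay | m≤n⇒m∸n≡0 j<k = z<s

  witnessE : Expr
  witnessE = ifz (runηE 1 2 0) zE (elet (sucE (var 0)) (elet (countMinAtE 2 0) (isZeroE (emonus (var 0) (predE (var 5))))))

  searchE : Expr
  searchE = elet (fstE (fstE (var 0))) (elet (sndE (fstE (var 1))) (elet (sndE (var 2))
              (ifz (var 2) zE (isZeroE (bsum (var 0) witnessE)))))

  witnessE-correct : ∀ k x s y → evalE witnessE (y ∷ s ∷ x ∷ k ∷ ⟪ ⟪ k , x ⟫ , s ⟫ ∷ []) ≡ witnessAt (pred k) x s y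
  witnessE-correct k x s y rewrite runηE-correct 1 2 0 (y ∷ s ∷ x ∷ k ∷ ⟪ ⟪ k , x ⟫ , s ⟫ ∷ [])
    | countMinAtE-correct 2 0 (suc y ∷ y ∷ s ∷ x ∷ k ∷ ⟪ ⟪ k , x ⟫ , s ⟫ ∷ []) | predPR-correct k = refl

  searchE-correct : ∀ k x s → evalE searchE (⟪ ⟪ k , x ⟫ , s ⟫ ∷ []) ≡ searchB k x s
  searchE-correct k x s rewrite fst-pair ⟪ k , x ⟫ s | snd-pair ⟪ k , x ⟫ s | fst-pair k x | snd-pair k x with k
  ... | zero  = refl
  ... | suc k = cong isZero (sumTo-cong s (λ y _ → witnessE-correct (suc k) x s y))

  -- Abstract: unfolding this code during unification is prohibitively expensive.
  abstract
    searchPR : PR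
    searchPR = toPR searchE

    searchPR-correct : ∀ k x s → evalPR searchPR ⟪ ⟪ k , x ⟫ , s ⟫ ≡ searchB k x s
    searchPR-correct k x s = trans (toPR-correct searchE ⟪ ⟪ k , x ⟫ , s ⟫) (searchE-correct k x s)

  searchPR-evaluates : ∀ k x s → toCode searchPR ⊢ ⟪ ⟪ k , x ⟫ , s ⟫ ↦ searchB k x s
  searchPR-evaluates k x s =
    subst (toCode searchPR ⊢ ⟪ ⟪ k , x ⟫ , s ⟫ ↦_) (searchPR-correct k x s) (toCode-computes searchPR _)

  BCode : Code
  BCode = Mu (toCode searchPR)

  BCode-sound : ∀ {k x v} → BCode ⊢ ⟪ k , x ⟫ ↦ v → Bset k x
  BCode-sound {k} {x} {v} (ev-Mu d _) =
    searchB-sound k x v (sym (trans (toCode-functional searchPR d) (searchPR-correct k x v)))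

  BCode-complete : ∀ {k x} → Bset k x → ∃ λ v → BCode ⊢ ⟪ k , x ⟫ ↦ v
  BCode-complete {k} {x} b with searchB-complete k x b
  ... | s , e with least (λ s → searchB k x s ≡ 0) s e
  ... | s₀ , e₀ , _ , below = s₀ , ev-Mu root (λ j j<s₀ → nonRoot j (below j j<s₀))
    where
    root : toCode searchPR ⊢ ⟪ ⟪ k , x ⟫ , s₀ ⟫ ↦ 0
    root = subst (toCode searchPR ⊢ ⟪ ⟪ k , x ⟫ , s₀ ⟫ ↦_) e₀ (searchPR-evaluates k x s₀)
    nonRoot : ∀ j → searchB k x j ≢ 0 → ∃ λ v → toCode searchPR ⊢ ⟪ ⟪ k , x ⟫ , j ⟫ ↦ suc v
    nonRoot j ≢0 = pred (searchB k x j) ,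
      subst (toCode searchPR ⊢ ⟪ ⟪ k , x ⟫ , j ⟫ ↦_) (sym (suc-pred _ {{≢-nonZero ≢0}})) (searchPR-evaluates k x j)

  BIdx : ℕ
  BIdx = encode BCode

  W-BIdx≐Bset : ∀ k → (λ x → W BIdx ⟪ k , x ⟫) ≐ Bset k
  W-BIdx≐Bset k x = (λ w → BCode-sound (proj₂ (W-encode BCode _ w)))
                  , (λ b → let (v , d) = BCode-complete b in encode-W BCode _ v d)

  Bset-closed : ∀ k → Closed η (Bset k)
  Bset-closed zero    x y _ _ = tt
  Bset-closed (suc k) = Aset-closed k

  Bset-injective : ∀ {i j} → Bset i ≐ Bset j → i ≡ j
  Bset-injective {zero}  {zero}  _ = refl
  Bset-injective {zero}  {suc j} ℕ≐Aj = ⊥-elim (Aset≢ℕ j λ x → proj₁ (ℕ≐Aj x) tt)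
  Bset-injective {suc i} {zero}  Ai≐ℕ = ⊥-elim (Aset≢ℕ i λ x → proj₂ (Ai≐ℕ x) tt)
  Bset-injective {suc i} {suc j} Ai≐Aj with <-cmp i j
  ... | tri< i<j _ _ = ⊥-elim (Aset-strictMono i<j Ai≐Aj)
  ... | tri≈ _ i≡j _ = cong suc i≡j
  ... | tri> _ _ j<i = ⊥-elim (Aset-strictMono j<i (≐-sym Ai≐Aj))

  𝒜ℕ⇔Bset : ∀ L → (𝒜ℕ η L → ∃ λ k → L ≐ Bset k) × ((∃ λ k → L ≐ Bset k) → 𝒜ℕ η L)
  𝒜ℕ⇔Bset L = to , from
    where
    to : 𝒜ℕ η L → ∃ λ k → L ≐ Bset k
    to (inj₁ (n , L≐An)) = suc n , L≐An
    to (inj₂ all)        = 0 , λ x → (λ _ → tt) , (λ _ → all x)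
    from : (∃ λ k → L ≐ Bset k) → 𝒜ℕ η L
    from (zero  , L≐ℕ)  = inj₂ λ x → proj₂ (L≐ℕ x) tt
    from (suc n , L≐An) = inj₁ (n , L≐An)

  𝒜ℕ-isηFamily : IsηFamily η (𝒜ℕ η)
  𝒜ℕ-isηFamily = BIdx , closed , distinct , enumerates
    where
    B : ℕ → Subset
    B k x = W BIdx ⟪ k , x ⟫
    closed : ∀ k → Closed η (B k)
    closed k x y ηxy w = proj₂ (W-BIdx≐Bset k y) (Bset-closed k x y ηxy (proj₁ (W-BIdx≐Bset k x) w))
    distinct : ∀ i j → i ≢ j → ¬ (B i ≐ B j)
    distinct i j i≢j Bi≐Bj = i≢j (Bset-injective (≐-trans (≐-sym (W-BIdx≐Bset i)) (≐-trans Bi≐Bj (W-BIdx≐Bset j))))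
    enumerates : ∀ L → (𝒜ℕ η L → ∃ λ k → L ≐ B k) × ((∃ λ k → L ≐ B k) → 𝒜ℕ η L)
    enumerates L =
      (λ l → let (k , L≐Bk) = proj₁ (𝒜ℕ⇔Bset L) l in k , ≐-trans L≐Bk (≐-sym (W-BIdx≐Bset k))) ,
      (λ { (k , L≐Bk) → proj₂ (𝒜ℕ⇔Bset L) (k , ≐-trans L≐Bk (W-BIdx≐Bset k)) })

  ACode : ℕ → Code
  ACode k = Comp BCode (toCode (ppair (constPR (suc k)) idPR))

  AIdx : ℕ → ℕ
  AIdx k = encode (ACode k)

  ACode-evaluates⇔ : ∀ k y v → (ACode k ⊢ y ↦ v → BCode ⊢ ⟪ suc k , y ⟫ ↦ v) × (BCode ⊢ ⟪ suc k , y ⟫ ↦ v → ACode k ⊢ y ↦ v)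
  ACode-evaluates⇔ k y v = (λ { (ev-Comp d₁ d₂) → subst (BCode ⊢_↦ v) (trans (toCode-functional tag d₁) tagged) d₂ })
                         , (λ d → ev-Comp (subst (toCode tag ⊢ y ↦_) tagged (toCode-computes tag y)) d)
    where
    tag : PR
    tag = ppair (constPR (suc k)) idPR
    tagged : evalPR tag y ≡ ⟪ suc k , y ⟫
    tagged = cong₂ ⟪_,_⟫ (constPR-correct (suc k) y) (idPR-correct y)

  W-AIdx≐Aset : ∀ k → W (AIdx k) ≐ Aset η k
  W-AIdx≐Aset k y =
    (λ w → let (v , d) = W-encode (ACode k) y w in BCode-sound (proj₁ (ACode-evaluates⇔ k y v) d)) ,
    (λ a → let (v , d) = BCode-complete {suc k} a in encode-W (ACode k) y v (proj₂ (ACode-evaluates⇔ k y v) d))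

  Hyp-AIdx : ∀ k → Hyp η (AIdx k) ≐ Aset η k
  Hyp-AIdx k x = (λ (y , ηxy , w) → Aset-closed k y x (η-sym ηxy) (proj₁ (W-AIdx≐Aset k y) w))
               , (λ a → x , η-refl , proj₂ (W-AIdx≐Aset k x) a)

  -- The learner

  occurs : ℕ → ℕ → ℕ
  occurs w z = sign (sumTo (λ i → eqℕ (entryCode w i) (suc z)) w)

  missing : ℕ → ℕ → ℕ
  missing w z = if0 (isMinAt w z) 0 (isZero (occurs w z))

  firstMissing : ℕ → ℕ
  firstMissing w = sumTo (λ i → isZero (sumTo (missing w) (suc i))) w

  guess : ℕ → ℕ
  guess w = countMinAt w (firstMissing w)

  learner : Learner
  learner σ = just (AIdx (guess (encSeq σ)))

  module _ (T : ℕ → Maybe ℕ) (N : ℕ) where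
    private
      w : ℕ
      w = encSeq (T [ N ])

      entry-w-< : ∀ {i} → i < N → entryCode w i ≡ encElem (T i)
      entry-w-< i<N = trans (entryCode-encSeq (T [ N ]) _) (entry-applyUpTo-< T i<N)

      entry-w-≥ : ∀ {i} → N ≤ i → entryCode w i ≡ 0
      entry-w-≥ N≤i = trans (entryCode-encSeq (T [ N ]) _) (entry-applyUpTo-≥ T N≤i)

    occurs-sound : ∀ z → 0 < occurs w z → ∃ λ i → T i ≡ just z
    occurs-sound z p with sumTo-positive⁻¹ (λ i → eqℕ (entryCode w i) (suc z)) w (sign-positive⁻¹ p)
    ... | i , _ , hit with eqℕ-positive _ _ hit | i <? N
    ...   | e | yes i<N = i , encElem≡suc (T i) (trans (sym (entry-w-< i<N)) e)
    ...   | e | no i≮N  = ⊥-elim (0≢1+n (trans (sym (entry-w-≥ (≮⇒≥ i≮N))) e))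

    occurs-complete : ∀ z {i} → i < N → T i ≡ just z → occurs w z ≡ 1
    occurs-complete z {i} i<N Ti =
      sign-positive (sumTo-positive (λ i → eqℕ (entryCode w i) (suc z)) i (<-≤-trans i<N (length≤encSeq T N)) hit)
      where
      hit : 0 < eqℕ (entryCode w i) (suc z)
      hit rewrite entry-w-< i<N | Ti | eqℕ-refl (suc z) = z<s

  text-covers : ∀ {T L} → Text T L → (P : ℕ → Set) → ∀ b → (∀ z → z < b → P z → L z) →
                Eventually (λ Q → ∀ z → z < b → P z → ∃ λ i → i < Q × T i ≡ just z)
  text-covers text P zero    _   = 0 , λ _ _ z ()
  text-covers {T} text P (suc b) P⊆L with lem {P b}
  ... | no ¬Pb = eventually-map extend (text-covers text P b (λ z z<b → P⊆L z (m≤n⇒m≤1+n z<b)))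
    where
    extend : ∀ {Q} → (∀ z → z < b → P z → ∃ λ i → i < Q × T i ≡ just z) →
             ∀ z → z < suc b → P z → ∃ λ i → i < Q × T i ≡ just z
    extend cover z z<1+b Pz with m≤n⇒m<n∨m≡n (≤-pred z<1+b)
    ... | inj₁ z<b  = cover z z<b Pz
    ... | inj₂ refl = ⊥-elim (¬Pb Pz)
  ... | yes Pb with proj₁ (text b) (P⊆L b ≤-refl Pb)
  ...   | i , Ti = eventually-map extend
            (eventually-× (text-covers text P b (λ z z<b → P⊆L z (m≤n⇒m≤1+n z<b))) (suc i , λ _ le → le))
    where
    extend : ∀ {Q} → (∀ z → z < b → P z → ∃ λ i → i < Q × T i ≡ just z) × i < Q →
             ∀ z → z < suc b → P z → ∃ λ i → i < Q × T i ≡ just z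
    extend (cover , i<Q) z z<1+b Pz with m≤n⇒m<n∨m≡n (≤-pred z<1+b)
    ... | inj₁ z<b  = cover z z<b Pz
    ... | inj₂ refl = i , i<Q , Ti

  module _ {n L T} (L≐An : L ≐ Aset η n) (text : Text T L) where
    private
      a : ℕ
      a = proj₁ (a-exists n)
      an : IsA η n a
      an = proj₂ (a-exists n)

      minima<a⊆L : ∀ z → z < a → IsMin η z → L z
      minima<a⊆L z z<a min-z with IsMin-below-IsA an min-z (<⇒≤ z<a)
      ... | i , i≤n , ai with m≤n⇒m<n∨m≡n i≤n
      ...   | inj₁ i<n  = proj₂ (L≐An z) (i , i<n , z , ai , η-refl)
      ...   | inj₂ refl = ⊥-elim (<-irrefl (IsA-functional ai an) z<a)

    -- Once the text has shown a_0, ..., a_{n-1} and the stage has settled the minima up to a_n,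
    -- a_n is the least apparent minimum missing from the text.
    guess-correct : ∀ {N} → (∀ z → z < a → IsMin η z → ∃ λ i → i < N × T i ≡ just z) →
                    (∀ z → z < suc a → isMinAt (encSeq (T [ N ])) z ≡ isMin z) → a < N →
                    guess (encSeq (T [ N ])) ≡ n
    guess-correct {N} cover stable a<N = begin
      countMinAt w (firstMissing w) ≡⟨ cong (countMinAt w) (sumTo-zero-prefix (missing w) a≤w missing-below missing-a) ⟩
      countMinAt w a                ≡⟨ sumTo-cong a (λ z z<a → stable z (m≤n⇒m≤1+n z<a)) ⟩
      countMin a                    ≡⟨ countMin-IsA an ⟩
      n                             ∎
      where
      open ≡-Reasoning
      w = encSeq (T [ N ])
      a≤w : a ≤ w
      a≤w = <⇒≤ (<-≤-trans a<N (length≤encSeq T N))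
      missing-below : ∀ j → j < a → missing w j ≡ 0
      missing-below j j<a rewrite stable j (m≤n⇒m≤1+n j<a) with lem {IsMin η j}
      ... | no _    = refl
      ... | yes min-j with cover j j<a min-j
      ...   | i , i<N , Ti rewrite occurs-complete T N j i<N Ti = refl
      missing-a : 0 < missing w a
      missing-a rewrite stable a ≤-refl | isMin-IsMin (IsA⇒IsMin an) with occurs w a in eq
      ... | zero  = z<s
      ... | suc _ with occurs-sound T N a (subst (0 <_) (sym eq) z<s)
      ...   | i , Ti = ⊥-elim (IsA⇒∉Aset an (proj₁ (L≐An a) (proj₂ (text a) (i , Ti))))

    learner-converges : Eventually (λ N → learner (T [ N ]) ≡ just (AIdx n))
    learner-converges with eventually-× (text-covers text (IsMin η) a minima<a⊆L)
                             (eventually-× (isMinAt-stabilises (suc a)) (suc a , λ _ le → le))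
    ... | t , late = t , λ N t≤N → cong (λ k → just (AIdx k))
            (guess-correct (proj₁ (late N t≤N))
                           (proj₁ (proj₂ (late (encSeq (T [ N ])) (≤-trans t≤N (length≤encSeq T N)))))
                           (proj₂ (proj₂ (late N t≤N))))

  learner-learns : ExLearns η learner (𝒜 η)
  learner-learns L (n , L≐An) T text with learner-converges L≐An text
  ... | N , converges = AIdx n , N , converges , ≐-trans (Hyp-AIdx n) (≐-sym L≐An)

  entryE : ℕ → ℕ → Expr
  entryE w i = fstE (predE (nrec (var i) (var w) (sndE (predE (var 0)))))

  eqℕE : ℕ → ℕ → Expr
  eqℕE a b = ifz (emonus (var a) (var b)) (isZeroE (emonus (var b) (var a))) zE

  occursE : ℕ → ℕ → Expr
  occursE w z = signE (bsum (var w) (elet (entryE (suc w) 0) (elet (sucE (var (suc (suc z)))) (eqℕE 1 0))))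

  missingE : ℕ → ℕ → Expr
  missingE w z = ifz (isMinAtE w z) zE (isZeroE (occursE w z))

  firstMissingE : ℕ → Expr
  firstMissingE w = bsum (var w) (isZeroE (bsum (sucE (var 0)) (missingE (suc (suc w)) 0)))

  guessE : ℕ → Expr
  guessE w = elet (firstMissingE w) (countMinAtE (suc w) 0)

  constCodeE : ℕ → Expr
  constCodeE k = nrec (sucE (var k)) zE (epair (constE 4) (epair (constE ⟪ 1 , 0 ⟫) (var 0)))

  AIdxE : ℕ → Expr
  AIdxE k = epair (constE 4) (epair (constE BIdx) (epair (constE 5) (epair (constCodeE k) (constE (encode (toCode idPR))))))

  learnerE : Expr
  learnerE = elet (guessE 0) (sucE (AIdxE 0))

  entryE-correct : ∀ w i ρ → evalE (entryE w i) ρ ≡ entryCode (look w ρ) (look i ρ)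
  entryE-correct w i ρ = trans (cong fst (predPR-correct (natRec (look w ρ) (λ _ v → snd (evalPR predPR v)) (look i ρ))))
    (cong (λ v → fst (pred v)) (natRec-cong refl (λ _ v → cong snd (predPR-correct v)) (look i ρ)))

  occursE-correct : ∀ w z ρ → evalE (occursE w z) ρ ≡ occurs (look w ρ) (look z ρ)
  occursE-correct w z ρ = cong sign (sumTo-cong (look w ρ) (λ i _ → cong (λ e → eqℕ e (suc (look z ρ))) (entryE-correct (suc w) 0 (i ∷ ρ))))

  missingE-correct : ∀ w z ρ → evalE (missingE w z) ρ ≡ missing (look w ρ) (look z ρ)
  missingE-correct w z ρ rewrite isMinAtE-correct w z ρ | occursE-correct w z ρ = refl

  firstMissingE-correct : ∀ w ρ → evalE (firstMissingE w) ρ ≡ firstMissing (look w ρ)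
  firstMissingE-correct w ρ = sumTo-cong (look w ρ) λ i _ →
    cong isZero (sumTo-cong (suc i) λ j _ → missingE-correct (suc (suc w)) 0 (j ∷ i ∷ ρ))

  guessE-correct : ∀ w ρ → evalE (guessE w) ρ ≡ guess (look w ρ)
  guessE-correct w ρ rewrite firstMissingE-correct w ρ = countMinAtE-correct (suc w) 0 (firstMissing (look w ρ) ∷ ρ)

  constE-correct : ∀ n ρ → evalE (constE n) ρ ≡ n
  constE-correct n ρ = constPR-correct n 0

  constCodeE-correct : ∀ k ρ → evalE (constCodeE k) ρ ≡ encode (toCode (constPR (suc (look k ρ))))
  constCodeE-correct k ρ = go (suc (look k ρ))
    where
    iteration : ℕ → ℕ
    iteration = natRec 0 (λ i v → evalE (epair (constE 4) (epair (constE ⟪ 1 , 0 ⟫) (var 0))) (v ∷ i ∷ ρ))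
    step : ℕ → List ℕ
    step n = iteration n ∷ n ∷ ρ
    go : ∀ n → iteration n ≡ encode (toCode (constPR n))
    go zero    = sym encode-Z
    go (suc n) = trans (cong₂ ⟪_,_⟫ (constE-correct 4 (step n)) (cong₂ ⟪_,_⟫ (trans (constE-correct ⟪ 1 , 0 ⟫ (step n)) (sym encode-S)) (go n)))
                       (sym (encode-Comp S (toCode (constPR n))))

  AIdxE-correct : ∀ k ρ → evalE (AIdxE k) ρ ≡ AIdx (look k ρ)
  AIdxE-correct k ρ = begin
    evalE (AIdxE k) ρ
      ≡⟨ cong₂ ⟪_,_⟫ (constE-correct 4 ρ) (cong₂ ⟪_,_⟫ (constE-correct BIdx ρ) (cong₂ ⟪_,_⟫ (constE-correct 5 ρ)
           (cong₂ ⟪_,_⟫ (constCodeE-correct k ρ) (constE-correct (encode (toCode idPR)) ρ)))) ⟩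
    ⟪ 4 , ⟪ BIdx , ⟪ 5 , ⟪ encode (toCode (constPR (suc (look k ρ)))) , encode (toCode idPR) ⟫ ⟫ ⟫ ⟫
      ≡⟨ cong (λ t → ⟪ 4 , ⟪ BIdx , t ⟫ ⟫) (encode-Pair (toCode (constPR (suc (look k ρ)))) (toCode idPR)) ⟨
    ⟪ 4 , ⟪ BIdx , encode (toCode (ppair (constPR (suc (look k ρ))) idPR)) ⟫ ⟫
      ≡⟨ encode-Comp BCode (toCode (ppair (constPR (suc (look k ρ))) idPR)) ⟨
    AIdx (look k ρ) ∎
    where open ≡-Reasoning

  learnerE-correct : ∀ w → evalE learnerE (w ∷ []) ≡ suc (AIdx (guess w))
  learnerE-correct w = cong suc (trans (AIdxE-correct 0 (evalE (guessE 0) (w ∷ []) ∷ w ∷ [])) (cong AIdx (guessE-correct 0 (w ∷ []))))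

  learnerPR : PR
  learnerPR = toPR learnerE

  learnerPR-correct : ∀ w → evalPR learnerPR w ≡ suc (AIdx (guess w))
  learnerPR-correct w = trans (toPR-correct learnerE w) (learnerE-correct w)

  learner-recursive : Recursive learner
  learner-recursive = encode (toCode learnerPR) , λ σ → decode-encode-⊢
    (subst (toCode learnerPR ⊢ encSeq σ ↦_) (learnerPR-correct (encSeq σ)) (toCode-computes learnerPR (encSeq σ)))

  𝒜-exLearnable : ExLearnable η (𝒜 η)
  𝒜-exLearnable = learner , learner-recursive , learner-learns

  -- Diagonalisation

  Identifies : Learner → Subset → (ℕ → Maybe ℕ) → Set
  Identifies M L T = Eventually (λ n → ∃ λ e → M (T [ n ]) ≡ just e × Hyp η e ≐ L)


  -- A learner that identifies every A_{j+1} conjectures each of them on a single text T* for ℕ: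
  -- at stage j the prefix is continued by an enumeration of A_{j+1} until the learner has settled
  -- on A_{j+1} and j itself has been listed.
  module Diagonal (M : Learner) (identifies : ∀ j T → Text T (Aset η (suc j)) → Identifies M (Aset η (suc j)) T) where

    record Prefix (j : ℕ) : Set where
      field
        text    : ℕ → Maybe ℕ
        length  : ℕ
        content : ∀ n x → n < length → text n ≡ just x → Aset η j x
    open Prefix

    enumA : ℕ → ℕ → Maybe ℕ
    enumA j m with lem {Aset η (suc j) m}
    ... | yes _ = just m
    ... | no _  = nothing

    enumA-sound : ∀ j m {x} → enumA j m ≡ just x → Aset η (suc j) x
    enumA-sound j m e with lem {Aset η (suc j) m}
    enumA-sound j m refl | yes m∈A = m∈A
    enumA-sound j m ()   | no _

    enumA-complete : ∀ j m → Aset η (suc j) m → enumA j m ≡ just m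
    enumA-complete j m m∈A with lem {Aset η (suc j) m}
    ... | yes _  = refl
    ... | no m∉A = ⊥-elim (m∉A m∈A)

    continue : ∀ {j} → Prefix j → ℕ → Maybe ℕ
    continue {j} p n with n <? length p
    ... | yes _ = text p n
    ... | no _  = enumA j (n ∸ length p)

    continue-beyond : ∀ {j} (p : Prefix j) x → continue p (length p + x) ≡ enumA j x
    continue-beyond p x with (length p + x) <? length p
    ... | yes lt = ⊥-elim (<-irrefl refl (≤-trans lt (m≤m+n (length p) x)))
    ... | no _   = cong (enumA _) (m+n∸m≡n (length p) x)

    continue-text : ∀ {j} (p : Prefix j) → Text (continue p) (Aset η (suc j))
    continue-text {j} p x = (λ x∈A → length p + x , trans (continue-beyond p x) (enumA-complete j x x∈A)) , from
      where
      from : (∃ λ n → continue p n ≡ just x) → Aset η (suc j) x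
      from (n , e) with n <? length p
      ... | yes n<len = Aset-mono (n≤1+n j) (content p n x n<len e)
      ... | no _      = enumA-sound j (n ∸ length p) e

    checkpoint : ∀ {j} → Prefix j → ℕ
    checkpoint {j} p = proj₁ (identifies j (continue p) (continue-text p)) ⊔ (length p + j)

    next : ∀ {j} → Prefix j → Prefix (suc j)
    next p = record { text = continue p ; length = suc (checkpoint p)
                    ; content = λ n x _ e → proj₂ (continue-text p x) (n , e) }

    prefix : ∀ j → Prefix j
    prefix zero    = record { text = λ _ → nothing ; length = 0 ; content = λ n x () }
    prefix (suc j) = next (prefix j)

    len : ℕ → ℕ
    len j = length (prefix j)

    len-grows : ∀ j → len j + j < len (suc j)
    len-grows j = s≤s (m≤n⊔m _ (len j + j))

    len-mono : ∀ {j j′} → j ≤ j′ → len j ≤ len j′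
    len-mono {j} {j′} j≤j′ with m≤n⇒m<n∨m≡n j≤j′
    ... | inj₂ refl = ≤-refl
    len-mono {j} {suc j′} _ | inj₁ j<1+j′ =
      ≤-trans (len-mono (≤-pred j<1+j′)) (≤-trans (m≤m+n (len j′) j′) (<⇒≤ (len-grows j′)))

    n≤len : ∀ j → j ≤ len j
    n≤len zero    = z≤n
    n≤len (suc j) = ≤-trans (s≤s (≤-trans (n≤len j) (m≤m+n (len j) j))) (len-grows j)

    prefix-stable : ∀ j d n → n < len j → text (prefix (d + j)) n ≡ text (prefix j) n
    prefix-stable j zero    n n<len = refl
    prefix-stable j (suc d) n n<len with n <? len (d + j)
    ... | yes _    = prefix-stable j d n n<len
    ... | no n≮len = ⊥-elim (n≮len (<-≤-trans n<len (len-mono (m≤n+m j d))))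

    T* : ℕ → Maybe ℕ
    T* n = text (prefix (suc n)) n

    T*-agrees : ∀ j n → n < len j → T* n ≡ text (prefix j) n
    T*-agrees j n n<len with ≤-total j (suc n)
    ... | inj₁ j≤1+n = trans (cong (λ k → text (prefix k) n) (sym (m∸n+n≡m j≤1+n))) (prefix-stable j (suc n ∸ j) n n<len)
    ... | inj₂ 1+n≤j = trans (sym (prefix-stable (suc n) (j ∸ suc n) n (<-≤-trans (n<1+n n) (n≤len (suc n)))))
                             (cong (λ k → text (prefix k) n) (m∸n+n≡m 1+n≤j))

    T*-text : Text T* (λ _ → ⊤)
    T*-text x = (λ _ → len x + x , trans (T*-agrees (suc x) (len x + x) (len-grows x)) listed) , (λ _ → tt)
      where
      listed : continue (prefix x) (len x + x) ≡ just x
      listed = trans (continue-beyond (prefix x) x) (enumA-complete x x (x∈Aset[1+x] x))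

    T*-conjectures : ∀ j → ∃ λ p → j ≤ p × ∃ λ e → M (T* [ p ]) ≡ just e × Hyp η e ≐ Aset η (suc j)
    T*-conjectures j =
      let (e , Me , correct) = proj₂ (identifies j (continue (prefix j)) (continue-text (prefix j))) p (m≤m⊔n _ (len j + j))
      in p , j≤p , e , trans (cong M (applyUpTo-cong p agree)) Me , correct
      where
      p = checkpoint (prefix j)
      j≤p : j ≤ p
      j≤p = ≤-trans (m≤n+m j (len j)) (m≤n⊔m _ (len j + j))
      agree : ∀ i → i < p → T* i ≡ continue (prefix j) i
      agree i i<p = T*-agrees (suc j) i (≤-trans i<p (n≤1+n p))

    learner-diverges : ¬ Converges M T*
    learner-diverges (o , N , stable) with T*-conjectures N | T*-conjectures (suc N)
    ... | p , N≤p , e , Me , correct | p′ , 1+N≤p′ , e′ , Me′ , correct′ =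
      Aset-strictMono ≤-refl (≐-trans (≐-sym correct) (subst (λ e → Hyp η e ≐ Aset η (suc (suc N))) (sym e≡e′) correct′))
      where
      e≡e′ : e ≡ e′
      e≡e′ = just-injective (trans (sym Me) (trans (stable p N≤p) (trans (sym (stable p′ (≤-trans (n≤1+n N) 1+N≤p′))) Me′)))

    learner-misses-ℕ : ¬ Identifies M (λ _ → ⊤) T*
    learner-misses-ℕ (N , correctℕ) with T*-conjectures N
    ... | p , N≤p , e , Me , correct with correctℕ p N≤p
    ...   | e′ , Me′ , correct′ =
      Aset≢ℕ (suc N) λ x → proj₂ (≐-trans (≐-sym correct) (subst (λ e → Hyp η e ≐ (λ _ → ⊤)) (sym e≡e′) correct′) x) tt
      where
      e≡e′ : e ≡ e′
      e≡e′ = just-injective (trans (sym Me) Me′)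

  𝒜-¬confLearnable : ¬ ConfLearnable η (𝒜 η)
  𝒜-¬confLearnable (M , _ , learns , converges) =
    learner-diverges (converges _ T* T*-text)
    where
    identifies : ∀ j T → Text T (Aset η (suc j)) → Identifies M (Aset η (suc j)) T
    identifies j T text = let (e , N , conv , correct) = learns (Aset η (suc j)) (suc j , ≐-refl) T text
                          in N , λ n N≤n → e , conv n N≤n , correct
    open Diagonal M identifies

  𝒜ℕ-¬bcLearnable : ¬ BcLearnable η (𝒜ℕ η)
  𝒜ℕ-¬bcLearnable (M , _ , learns) = learner-misses-ℕ (learns _ (inj₂ λ _ → tt) T* T*-text)
    where open Diagonal M (λ j → learns (Aset η (suc j)) (inj₁ (suc j , ≐-refl)))

theorem2 : ExcludedMiddle 0ℓ → (η : ℕ → ℕ → Set) → Positive η →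
    ExLearnable η (𝒜 η) × ¬ ConfLearnable η (𝒜 η) ×
    IsηFamily η (𝒜ℕ η) × ¬ BcLearnable η (𝒜ℕ η)
theorem2 lem η pos = 𝒜-exLearnable , 𝒜-¬confLearnable , 𝒜ℕ-isηFamily , 𝒜ℕ-¬bcLearnable
  where open Learnability lem η pos
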